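{- For each pair $(n,k)$ with (1) $n=4$ and $k\in\{5,7,9,11\}$, or (2) $n=5$ and $k\in\{5,7,9,11,13,15,27\}$, or (3) $n=6$ and $k=9$, or (4) $n=7$ and $k=13$, there exists a $k$-regular open XOR-magic graph of power $n$.
   Context: All graphs are simple; a graph is $k$-regular if every vertex has exactly $k$ neighbours. For a vertex $x$, $N(x)$ is its set of neighbours. A simple connected graph $G=(V,E)$ with $|V|=2^n$ is an open XOR-magic graph of power $n$ if there is a bijection $\ell:V\to(\mathbb{Z}_2)^n$ such that $\sum_{y\in N(x)}\ell(y)$ is the zero vector of $(\mathbb{Z}_2)^n$ for every $x\in V$. -}

module Defs where

open import Data.Nat using (ℕ; zero; suc; _+_; _^_)
open import Data.Bool using (Bool; true; false; if_then_else_; _xor_)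
open import Data.Fin using (Fin)
open import Data.List using (List; allFin; foldr; map)
open import Data.Nat.ListAction using (sum)
open import Data.Vec using (Vec; replicate; zipWith)
open import Data.Product using (Σ; _×_)
open import Function.Bundles using (_⤖_; Bijection)
open import Relation.Binary.PropositionalEquality using (_≡_)

-- (ℤ₂)ⁿ represented as Vec Bool n, with addition = componentwise xor
𝔽₂^ : ℕ → Set
𝔽₂^ n = Vec Bool n

0ᵥ : ∀ {n} → 𝔽₂^ n
0ᵥ = replicate _ false

_⊕_ : ∀ {n} → 𝔽₂^ n → 𝔽₂^ n → 𝔽₂^ n
_⊕_ = zipWith _xor_

record SimpleGraph (N : ℕ) : Set where
  field
    Adj    : Fin N → Fin N → Bool
    sym    : ∀ x y → Adj x y ≡ Adj y x
    irrefl : ∀ x → Adj x x ≡ false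
open SimpleGraph public

degree : ∀ {N} → SimpleGraph N → Fin N → ℕ
degree G x = sum (map (λ y → if Adj G x y then 1 else 0) (allFin _))

IsRegular : ∀ {N} → ℕ → SimpleGraph N → Set
IsRegular k G = ∀ x → degree G x ≡ k

data Reachable {N} (G : SimpleGraph N) : Fin N → Fin N → Set where
  here : ∀ {x} → Reachable G x x
  step : ∀ {x y z} → Adj G x y ≡ true → Reachable G y z → Reachable G x z

Connected : ∀ {N} → SimpleGraph N → Set
Connected G = ∀ x y → Reachable G x y

neighbourSum : ∀ {N n} → SimpleGraph N → (Fin N → 𝔽₂^ n) → Fin N → 𝔽₂^ n
neighbourSum G ℓ x =
  foldr (λ y acc → if Adj G x y then ℓ y ⊕ acc else acc) 0ᵥ (allFin _)

IsOpenXORMagic : (n : ℕ) → SimpleGraph (2 ^ n) → Set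
IsOpenXORMagic n G =
  Connected G ×
  Σ (Fin (2 ^ n) ⤖ 𝔽₂^ n) λ ℓ →
    ∀ x → neighbourSum G (Bijection.to ℓ) x ≡ 0ᵥ

data Case : ℕ → ℕ → Set where
  c4-5 : Case 4 5
  c4-7 : Case 4 7
  c4-9 : Case 4 9
  c4-11 : Case 4 11
  c5-5 : Case 5 5
  c5-7 : Case 5 7
  c5-9 : Case 5 9
  c5-11 : Case 5 11
  c5-13 : Case 5 13
  c5-15 : Case 5 15
  c5-27 : Case 5 27
  c6-9 : Case 6 9
  c7-13 : Case 7 13

{-# OPTIONS --safe #-}
module Submission where

-- The graphs are explicit witnesses. Once vertex i is labelled by its binary expansion, regularity
-- and the vanishing of every open neighbourhood sum are finite checks, and connectivity is witnessed
-- by parent pointers along edges that lead every vertex to a common root within 2^n steps.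

open import Defs hiding (sym)
open import Data.Bool as Bool using (Bool; true; not; _∧_; _∨_)
open import Data.Bool.Properties using (∨-comm)
open import Data.Fin using (Fin; zero; suc; toℕ; #_)
open import Data.Fin.Properties using (_≟_; all?; 2↔Bool; *↔×)
open import Data.List using (List; []; _∷_)
open import Data.Nat as ℕ using (ℕ; _^_)
open import Data.List.Membership.DecPropositional ℕ._≟_ using (_∈?_)
open import Data.Nat.GeneralisedArithmetic using (iterate)
open import Data.Product using (Σ; _×_; _,_; uncurry)
open import Data.Product.Function.NonDependent.Propositional using (_×-↔_)
open import Data.Sum using (_⊎_; inj₁; inj₂)
open import Data.Vec using (Vec; []; _∷_; lookup; uncons)
open import Data.Vec.Properties using (≡-dec)
open import Function.Bundles using (_↔_; mk↔ₛ′; Inverse)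
open import Function.Properties.Inverse using (↔-trans; ↔-sym; ↔⇒⤖)
open import Relation.Nullary.Decidable using (Dec; does; True; toWitness; map′; dec-true; does-≡; _×-dec_; _⊎-dec_)
open import Relation.Binary.PropositionalEquality using (_≡_; refl; sym; trans; cong; cong₂; subst)

Vec-suc↔× : ∀ {A : Set} {n} → Vec A (ℕ.suc n) ↔ (A × Vec A n)
Vec-suc↔× = mk↔ₛ′ uncons (uncurry _∷_) (λ _ → refl) λ { (_ ∷ _) → refl }

-- Vertex i gets the binary digits of i, most significant first.
2^↔𝔽₂^ : ∀ n → Fin (2 ^ n) ↔ 𝔽₂^ n
2^↔𝔽₂^ ℕ.zero    = mk↔ₛ′ (λ _ → []) (λ _ → zero) (λ { [] → refl }) λ { zero → refl ; (suc ()) }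
2^↔𝔽₂^ (ℕ.suc n) = ↔-trans *↔× (↔-trans (2↔Bool ×-↔ 2^↔𝔽₂^ n) (↔-sym Vec-suc↔×))

module _ {N : ℕ} (G : SimpleGraph N) where

  Reachable-snoc : ∀ {x y z} → Reachable G x y → Adj G y z ≡ true → Reachable G x z
  Reachable-snoc here        yz = step yz here
  Reachable-snoc (step xw p) yz = step xw (Reachable-snoc p yz)

  Reachable-sym : ∀ {x y} → Reachable G x y → Reachable G y x
  Reachable-sym here                = here
  Reachable-sym (step {x} {w} xw p) =
    Reachable-snoc (Reachable-sym p) (trans (SimpleGraph.sym G w x) xw)

  Reachable-trans : ∀ {x y z} → Reachable G x y → Reachable G y z → Reachable G x z
  Reachable-trans here        q = q
  Reachable-trans (step xw p) q = step xw (Reachable-trans p q)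

  module _ (root : Fin N) (parent : Fin N → Fin N)
           (parent-adj : ∀ x → x ≡ root ⊎ Adj G x (parent x) ≡ true) where

    reaches-root : ∀ m x → iterate parent x m ≡ root → Reachable G x root
    reaches-root ℕ.zero    x x≡root = subst (Reachable G x) x≡root here
    reaches-root (ℕ.suc m) x reached with parent-adj x
    ... | inj₁ x≡root = subst (Reachable G x) x≡root here
    ... | inj₂ adj    = step adj (reaches-root m (parent x) reached)

    connected-by-parents : ∀ m → (∀ x → iterate parent x m ≡ root) → Connected G
    connected-by-parents m reached x y =
      Reachable-trans (reaches-root m x (reached x)) (Reachable-sym (reaches-root m y (reached y)))

-- Symmetrised and loop-free whatever the lists are; for symmetric loop-free lists, such as those
-- below, y is adjacent to x exactly when y is listed at x.
fromNeighbourLists : ∀ {N} → Vec (List ℕ) N → SimpleGraph N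
fromNeighbourLists {N} neighbours = record
  { Adj    = adjacent
  ; sym    = λ x y →
      cong₂ (λ a b → not a ∧ b) (≟-does-sym x y) (∨-comm (listed x y) (listed y x))
  ; irrefl = λ x → cong (λ a → not a ∧ (listed x x ∨ listed x x)) (dec-true (x ≟ x) refl)
  }
  where
  listed : Fin N → Fin N → Bool
  listed x y = does (toℕ y ∈? lookup neighbours x)

  adjacent : Fin N → Fin N → Bool
  adjacent x y = not (does (x ≟ y)) ∧ (listed x y ∨ listed y x)

  ≟-does-sym : ∀ x y → does (x ≟ y) ≡ does (y ≟ x)
  ≟-does-sym x y = does-≡ (x ≟ y) (map′ sym sym (y ≟ x))

record Certificate (N : ℕ) : Set where
  field
    neighbours : Vec (List ℕ) N
    root       : Fin N
    parents    : Vec (Fin N) N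

  graph : SimpleGraph N
  graph = fromNeighbourLists neighbours

  parent : Fin N → Fin N
  parent = lookup parents

module _ (n k : ℕ) (c : Certificate (2 ^ n)) where
  open Certificate c

  label : Fin (2 ^ n) → 𝔽₂^ n
  label = Inverse.to (2^↔𝔽₂^ n)

  IsValid : Set
  IsValid = IsRegular k graph
          × (∀ x → neighbourSum graph label x ≡ 0ᵥ)
          × (∀ x → x ≡ root ⊎ Adj graph x (parent x) ≡ true)
          × (∀ x → iterate parent x (2 ^ n) ≡ root)

  isValid? : Dec IsValid
  isValid? = all? (λ x → degree graph x ℕ.≟ k)
       ×-dec all? (λ x → ≡-dec Bool._≟_ (neighbourSum graph label x) 0ᵥ)
       ×-dec all? (λ x → x ≟ root ⊎-dec Adj graph x (parent x) Bool.≟ true)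
       ×-dec all? (λ x → iterate parent x (2 ^ n) ≟ root)

  -- Implicit, so that Agda discharges it by η for ⊤ after evaluating isValid?; checking an
  -- explicit tt against it instead is many times slower.
  fromCertificate : {True isValid?} →
                    Σ (SimpleGraph (2 ^ n)) λ G → IsRegular k G × IsOpenXORMagic n G
  fromCertificate {valid} with toWitness valid
  ... | regular , magic , parent-adj , reached =
    graph , regular ,
    connected-by-parents graph root parent parent-adj (2 ^ n) reached , ↔⇒⤖ (2^↔𝔽₂^ n) , magic

graph4-5 : Certificate (2 ^ 4)
graph4-5 = record
  { root       = # 0
  ; parents    = # 0 ∷ # 0 ∷ # 0 ∷ # 1 ∷ # 0 ∷ # 1 ∷ # 2 ∷ # 8 ∷ # 0 ∷ # 8 ∷ # 6 ∷ # 6 ∷ # 15 ∷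
      # 8 ∷ # 15 ∷ # 0 ∷ []
  ; neighbours =
      (1 ∷ 2 ∷ 4 ∷ 8 ∷ 15 ∷ []) ∷
      (0 ∷ 2 ∷ 3 ∷ 4 ∷ 5 ∷ []) ∷
      (0 ∷ 1 ∷ 3 ∷ 4 ∷ 6 ∷ []) ∷
      (1 ∷ 2 ∷ 5 ∷ 8 ∷ 14 ∷ []) ∷
      (0 ∷ 1 ∷ 2 ∷ 5 ∷ 6 ∷ []) ∷
      (1 ∷ 3 ∷ 4 ∷ 9 ∷ 15 ∷ []) ∷
      (2 ∷ 4 ∷ 7 ∷ 10 ∷ 11 ∷ []) ∷
      (6 ∷ 8 ∷ 12 ∷ 13 ∷ 15 ∷ []) ∷
      (0 ∷ 3 ∷ 7 ∷ 9 ∷ 13 ∷ []) ∷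
      (5 ∷ 8 ∷ 10 ∷ 11 ∷ 12 ∷ []) ∷
      (6 ∷ 9 ∷ 12 ∷ 13 ∷ 14 ∷ []) ∷
      (6 ∷ 9 ∷ 12 ∷ 13 ∷ 14 ∷ []) ∷
      (7 ∷ 9 ∷ 10 ∷ 11 ∷ 15 ∷ []) ∷
      (7 ∷ 8 ∷ 10 ∷ 11 ∷ 14 ∷ []) ∷
      (3 ∷ 10 ∷ 11 ∷ 13 ∷ 15 ∷ []) ∷
      (0 ∷ 5 ∷ 7 ∷ 12 ∷ 14 ∷ []) ∷
      []
  }

graph4-7 : Certificate (2 ^ 4)
graph4-7 = record
  { root       = # 0
  ; parents    = # 0 ∷ # 0 ∷ # 0 ∷ # 0 ∷ # 0 ∷ # 0 ∷ # 0 ∷ # 0 ∷ # 1 ∷ # 4 ∷ # 3 ∷ # 1 ∷ # 4 ∷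
      # 6 ∷ # 7 ∷ # 7 ∷ []
  ; neighbours =
      (1 ∷ 2 ∷ 3 ∷ 4 ∷ 5 ∷ 6 ∷ 7 ∷ []) ∷
      (0 ∷ 2 ∷ 3 ∷ 4 ∷ 6 ∷ 8 ∷ 11 ∷ []) ∷
      (0 ∷ 1 ∷ 3 ∷ 4 ∷ 5 ∷ 8 ∷ 11 ∷ []) ∷
      (0 ∷ 1 ∷ 2 ∷ 4 ∷ 5 ∷ 8 ∷ 10 ∷ []) ∷
      (0 ∷ 1 ∷ 2 ∷ 3 ∷ 5 ∷ 9 ∷ 12 ∷ []) ∷
      (0 ∷ 2 ∷ 3 ∷ 4 ∷ 7 ∷ 8 ∷ 10 ∷ []) ∷
      (0 ∷ 1 ∷ 7 ∷ 8 ∷ 9 ∷ 10 ∷ 13 ∷ []) ∷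
      (0 ∷ 5 ∷ 6 ∷ 9 ∷ 11 ∷ 14 ∷ 15 ∷ []) ∷
      (1 ∷ 2 ∷ 3 ∷ 5 ∷ 6 ∷ 13 ∷ 14 ∷ []) ∷
      (4 ∷ 6 ∷ 7 ∷ 11 ∷ 12 ∷ 13 ∷ 15 ∷ []) ∷
      (3 ∷ 5 ∷ 6 ∷ 12 ∷ 13 ∷ 14 ∷ 15 ∷ []) ∷
      (1 ∷ 2 ∷ 7 ∷ 9 ∷ 12 ∷ 14 ∷ 15 ∷ []) ∷
      (4 ∷ 9 ∷ 10 ∷ 11 ∷ 13 ∷ 14 ∷ 15 ∷ []) ∷
      (6 ∷ 8 ∷ 9 ∷ 10 ∷ 12 ∷ 14 ∷ 15 ∷ []) ∷
      (7 ∷ 8 ∷ 10 ∷ 11 ∷ 12 ∷ 13 ∷ 15 ∷ []) ∷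
      (7 ∷ 9 ∷ 10 ∷ 11 ∷ 12 ∷ 13 ∷ 14 ∷ []) ∷
      []
  }

graph4-9 : Certificate (2 ^ 4)
graph4-9 = record
  { root       = # 0
  ; parents    = # 0 ∷ # 0 ∷ # 0 ∷ # 0 ∷ # 0 ∷ # 0 ∷ # 1 ∷ # 1 ∷ # 0 ∷ # 1 ∷ # 0 ∷ # 3 ∷ # 0 ∷
      # 3 ∷ # 4 ∷ # 0 ∷ []
  ; neighbours =
      (1 ∷ 2 ∷ 3 ∷ 4 ∷ 5 ∷ 8 ∷ 10 ∷ 12 ∷ 15 ∷ []) ∷
      (0 ∷ 2 ∷ 3 ∷ 4 ∷ 5 ∷ 6 ∷ 7 ∷ 8 ∷ 9 ∷ []) ∷
      (0 ∷ 1 ∷ 3 ∷ 4 ∷ 5 ∷ 6 ∷ 7 ∷ 8 ∷ 10 ∷ []) ∷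
      (0 ∷ 1 ∷ 2 ∷ 4 ∷ 5 ∷ 8 ∷ 11 ∷ 12 ∷ 13 ∷ []) ∷
      (0 ∷ 1 ∷ 2 ∷ 3 ∷ 6 ∷ 9 ∷ 12 ∷ 13 ∷ 14 ∷ []) ∷
      (0 ∷ 1 ∷ 2 ∷ 3 ∷ 6 ∷ 10 ∷ 13 ∷ 14 ∷ 15 ∷ []) ∷
      (1 ∷ 2 ∷ 4 ∷ 5 ∷ 7 ∷ 11 ∷ 12 ∷ 13 ∷ 15 ∷ []) ∷
      (1 ∷ 2 ∷ 6 ∷ 8 ∷ 9 ∷ 11 ∷ 12 ∷ 13 ∷ 14 ∷ []) ∷
      (0 ∷ 1 ∷ 2 ∷ 3 ∷ 7 ∷ 9 ∷ 10 ∷ 11 ∷ 15 ∷ []) ∷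
      (1 ∷ 4 ∷ 7 ∷ 8 ∷ 10 ∷ 12 ∷ 13 ∷ 14 ∷ 15 ∷ []) ∷
      (0 ∷ 2 ∷ 5 ∷ 8 ∷ 9 ∷ 11 ∷ 12 ∷ 14 ∷ 15 ∷ []) ∷
      (3 ∷ 6 ∷ 7 ∷ 8 ∷ 10 ∷ 12 ∷ 13 ∷ 14 ∷ 15 ∷ []) ∷
      (0 ∷ 3 ∷ 4 ∷ 6 ∷ 7 ∷ 9 ∷ 10 ∷ 11 ∷ 14 ∷ []) ∷
      (3 ∷ 4 ∷ 5 ∷ 6 ∷ 7 ∷ 9 ∷ 11 ∷ 14 ∷ 15 ∷ []) ∷
      (4 ∷ 5 ∷ 7 ∷ 9 ∷ 10 ∷ 11 ∷ 12 ∷ 13 ∷ 15 ∷ []) ∷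
      (0 ∷ 5 ∷ 6 ∷ 8 ∷ 9 ∷ 10 ∷ 11 ∷ 13 ∷ 14 ∷ []) ∷
      []
  }

graph4-11 : Certificate (2 ^ 4)
graph4-11 = record
  { root       = # 0
  ; parents    = # 0 ∷ # 0 ∷ # 0 ∷ # 0 ∷ # 0 ∷ # 0 ∷ # 0 ∷ # 0 ∷ # 0 ∷ # 0 ∷ # 0 ∷ # 0 ∷ # 1 ∷
      # 3 ∷ # 3 ∷ # 1 ∷ []
  ; neighbours =
      (1 ∷ 2 ∷ 3 ∷ 4 ∷ 5 ∷ 6 ∷ 7 ∷ 8 ∷ 9 ∷ 10 ∷ 11 ∷ []) ∷
      (0 ∷ 2 ∷ 3 ∷ 4 ∷ 5 ∷ 6 ∷ 7 ∷ 8 ∷ 10 ∷ 12 ∷ 15 ∷ []) ∷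
      (0 ∷ 1 ∷ 3 ∷ 4 ∷ 5 ∷ 8 ∷ 9 ∷ 10 ∷ 11 ∷ 12 ∷ 15 ∷ []) ∷
      (0 ∷ 1 ∷ 2 ∷ 4 ∷ 5 ∷ 9 ∷ 11 ∷ 12 ∷ 13 ∷ 14 ∷ 15 ∷ []) ∷
      (0 ∷ 1 ∷ 2 ∷ 3 ∷ 5 ∷ 6 ∷ 7 ∷ 11 ∷ 12 ∷ 13 ∷ 14 ∷ []) ∷
      (0 ∷ 1 ∷ 2 ∷ 3 ∷ 4 ∷ 6 ∷ 7 ∷ 9 ∷ 13 ∷ 14 ∷ 15 ∷ []) ∷
      (0 ∷ 1 ∷ 4 ∷ 5 ∷ 7 ∷ 8 ∷ 9 ∷ 10 ∷ 13 ∷ 14 ∷ 15 ∷ []) ∷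
      (0 ∷ 1 ∷ 4 ∷ 5 ∷ 6 ∷ 8 ∷ 10 ∷ 11 ∷ 12 ∷ 13 ∷ 14 ∷ []) ∷
      (0 ∷ 1 ∷ 2 ∷ 6 ∷ 7 ∷ 9 ∷ 11 ∷ 12 ∷ 13 ∷ 14 ∷ 15 ∷ []) ∷
      (0 ∷ 2 ∷ 3 ∷ 5 ∷ 6 ∷ 8 ∷ 10 ∷ 12 ∷ 13 ∷ 14 ∷ 15 ∷ []) ∷
      (0 ∷ 1 ∷ 2 ∷ 6 ∷ 7 ∷ 9 ∷ 11 ∷ 12 ∷ 13 ∷ 14 ∷ 15 ∷ []) ∷
      (0 ∷ 2 ∷ 3 ∷ 4 ∷ 7 ∷ 8 ∷ 10 ∷ 12 ∷ 13 ∷ 14 ∷ 15 ∷ []) ∷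
      (1 ∷ 2 ∷ 3 ∷ 4 ∷ 7 ∷ 8 ∷ 9 ∷ 10 ∷ 11 ∷ 13 ∷ 14 ∷ []) ∷
      (3 ∷ 4 ∷ 5 ∷ 6 ∷ 7 ∷ 8 ∷ 9 ∷ 10 ∷ 11 ∷ 12 ∷ 15 ∷ []) ∷
      (3 ∷ 4 ∷ 5 ∷ 6 ∷ 7 ∷ 8 ∷ 9 ∷ 10 ∷ 11 ∷ 12 ∷ 15 ∷ []) ∷
      (1 ∷ 2 ∷ 3 ∷ 5 ∷ 6 ∷ 8 ∷ 9 ∷ 10 ∷ 11 ∷ 13 ∷ 14 ∷ []) ∷
      []
  }

graph5-5 : Certificate (2 ^ 5)
graph5-5 = record
  { root       = # 0
  ; parents    = # 0 ∷ # 5 ∷ # 5 ∷ # 14 ∷ # 0 ∷ # 0 ∷ # 0 ∷ # 4 ∷ # 14 ∷ # 0 ∷ # 4 ∷ # 9 ∷ # 9 ∷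
      # 6 ∷ # 0 ∷ # 6 ∷ # 7 ∷ # 1 ∷ # 2 ∷ # 11 ∷ # 4 ∷ # 5 ∷ # 5 ∷ # 7 ∷ # 7 ∷ # 4 ∷ # 10 ∷ # 7 ∷
      # 10 ∷ # 1 ∷ # 9 ∷ # 1 ∷ []
  ; neighbours =
      (4 ∷ 5 ∷ 6 ∷ 9 ∷ 14 ∷ []) ∷
      (5 ∷ 17 ∷ 22 ∷ 29 ∷ 31 ∷ []) ∷
      (5 ∷ 16 ∷ 18 ∷ 26 ∷ 29 ∷ []) ∷
      (14 ∷ 16 ∷ 18 ∷ 19 ∷ 31 ∷ []) ∷
      (0 ∷ 7 ∷ 10 ∷ 20 ∷ 25 ∷ []) ∷
      (0 ∷ 1 ∷ 2 ∷ 21 ∷ 22 ∷ []) ∷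
      (0 ∷ 13 ∷ 15 ∷ 20 ∷ 22 ∷ []) ∷
      (4 ∷ 16 ∷ 23 ∷ 24 ∷ 27 ∷ []) ∷
      (14 ∷ 17 ∷ 18 ∷ 21 ∷ 24 ∷ []) ∷
      (0 ∷ 11 ∷ 12 ∷ 25 ∷ 30 ∷ []) ∷
      (4 ∷ 25 ∷ 26 ∷ 27 ∷ 28 ∷ []) ∷
      (9 ∷ 16 ∷ 17 ∷ 19 ∷ 27 ∷ []) ∷
      (9 ∷ 19 ∷ 24 ∷ 28 ∷ 30 ∷ []) ∷
      (6 ∷ 16 ∷ 23 ∷ 28 ∷ 29 ∷ []) ∷
      (0 ∷ 3 ∷ 8 ∷ 21 ∷ 30 ∷ []) ∷
      (6 ∷ 20 ∷ 23 ∷ 26 ∷ 31 ∷ []) ∷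
      (2 ∷ 3 ∷ 7 ∷ 11 ∷ 13 ∷ []) ∷
      (1 ∷ 8 ∷ 11 ∷ 21 ∷ 23 ∷ []) ∷
      (2 ∷ 3 ∷ 8 ∷ 21 ∷ 28 ∷ []) ∷
      (3 ∷ 11 ∷ 12 ∷ 26 ∷ 30 ∷ []) ∷
      (4 ∷ 6 ∷ 15 ∷ 23 ∷ 26 ∷ []) ∷
      (5 ∷ 8 ∷ 14 ∷ 17 ∷ 18 ∷ []) ∷
      (1 ∷ 5 ∷ 6 ∷ 29 ∷ 31 ∷ []) ∷
      (7 ∷ 13 ∷ 15 ∷ 17 ∷ 20 ∷ []) ∷
      (7 ∷ 8 ∷ 12 ∷ 29 ∷ 30 ∷ []) ∷
      (4 ∷ 9 ∷ 10 ∷ 27 ∷ 28 ∷ []) ∷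
      (2 ∷ 10 ∷ 15 ∷ 19 ∷ 20 ∷ []) ∷
      (7 ∷ 10 ∷ 11 ∷ 25 ∷ 31 ∷ []) ∷
      (10 ∷ 12 ∷ 13 ∷ 18 ∷ 25 ∷ []) ∷
      (1 ∷ 2 ∷ 13 ∷ 22 ∷ 24 ∷ []) ∷
      (9 ∷ 12 ∷ 14 ∷ 19 ∷ 24 ∷ []) ∷
      (1 ∷ 3 ∷ 15 ∷ 22 ∷ 27 ∷ []) ∷
      []
  }

graph5-7 : Certificate (2 ^ 5)
graph5-7 = record
  { root       = # 0
  ; parents    = # 0 ∷ # 10 ∷ # 15 ∷ # 5 ∷ # 10 ∷ # 0 ∷ # 15 ∷ # 17 ∷ # 5 ∷ # 18 ∷ # 0 ∷ # 5 ∷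
      # 5 ∷ # 10 ∷ # 19 ∷ # 0 ∷ # 0 ∷ # 0 ∷ # 0 ∷ # 0 ∷ # 16 ∷ # 10 ∷ # 16 ∷ # 18 ∷ # 16 ∷ # 19 ∷
      # 15 ∷ # 16 ∷ # 16 ∷ # 16 ∷ # 17 ∷ # 5 ∷ []
  ; neighbours =
      (5 ∷ 10 ∷ 15 ∷ 16 ∷ 17 ∷ 18 ∷ 19 ∷ []) ∷
      (6 ∷ 10 ∷ 11 ∷ 20 ∷ 22 ∷ 27 ∷ 30 ∷ []) ∷
      (11 ∷ 13 ∷ 15 ∷ 23 ∷ 24 ∷ 27 ∷ 29 ∷ []) ∷
      (5 ∷ 6 ∷ 13 ∷ 22 ∷ 25 ∷ 28 ∷ 29 ∷ []) ∷
      (8 ∷ 10 ∷ 12 ∷ 14 ∷ 15 ∷ 19 ∷ 28 ∷ []) ∷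
      (0 ∷ 3 ∷ 8 ∷ 11 ∷ 12 ∷ 19 ∷ 31 ∷ []) ∷
      (1 ∷ 3 ∷ 15 ∷ 17 ∷ 25 ∷ 26 ∷ 31 ∷ []) ∷
      (8 ∷ 17 ∷ 20 ∷ 21 ∷ 25 ∷ 26 ∷ 27 ∷ []) ∷
      (4 ∷ 5 ∷ 7 ∷ 12 ∷ 15 ∷ 17 ∷ 20 ∷ []) ∷
      (12 ∷ 18 ∷ 24 ∷ 26 ∷ 29 ∷ 30 ∷ 31 ∷ []) ∷
      (0 ∷ 1 ∷ 4 ∷ 12 ∷ 13 ∷ 17 ∷ 21 ∷ []) ∷
      (1 ∷ 2 ∷ 5 ∷ 18 ∷ 21 ∷ 30 ∷ 31 ∷ []) ∷
      (4 ∷ 5 ∷ 8 ∷ 9 ∷ 10 ∷ 18 ∷ 24 ∷ []) ∷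
      (2 ∷ 3 ∷ 10 ∷ 19 ∷ 21 ∷ 23 ∷ 26 ∷ []) ∷
      (4 ∷ 19 ∷ 21 ∷ 22 ∷ 23 ∷ 28 ∷ 31 ∷ []) ∷
      (0 ∷ 2 ∷ 4 ∷ 6 ∷ 8 ∷ 18 ∷ 26 ∷ []) ∷
      (0 ∷ 20 ∷ 22 ∷ 24 ∷ 27 ∷ 28 ∷ 29 ∷ []) ∷
      (0 ∷ 6 ∷ 7 ∷ 8 ∷ 10 ∷ 29 ∷ 30 ∷ []) ∷
      (0 ∷ 9 ∷ 11 ∷ 12 ∷ 15 ∷ 22 ∷ 23 ∷ []) ∷
      (0 ∷ 4 ∷ 5 ∷ 13 ∷ 14 ∷ 25 ∷ 27 ∷ []) ∷
      (1 ∷ 7 ∷ 8 ∷ 16 ∷ 22 ∷ 23 ∷ 31 ∷ []) ∷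
      (7 ∷ 10 ∷ 11 ∷ 13 ∷ 14 ∷ 24 ∷ 29 ∷ []) ∷
      (1 ∷ 3 ∷ 14 ∷ 16 ∷ 18 ∷ 20 ∷ 26 ∷ []) ∷
      (2 ∷ 13 ∷ 14 ∷ 18 ∷ 20 ∷ 25 ∷ 30 ∷ []) ∷
      (2 ∷ 9 ∷ 12 ∷ 16 ∷ 21 ∷ 25 ∷ 27 ∷ []) ∷
      (3 ∷ 6 ∷ 7 ∷ 19 ∷ 23 ∷ 24 ∷ 30 ∷ []) ∷
      (6 ∷ 7 ∷ 9 ∷ 13 ∷ 15 ∷ 22 ∷ 28 ∷ []) ∷
      (1 ∷ 2 ∷ 7 ∷ 16 ∷ 19 ∷ 24 ∷ 31 ∷ []) ∷
      (3 ∷ 4 ∷ 14 ∷ 16 ∷ 26 ∷ 29 ∷ 30 ∷ []) ∷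
      (2 ∷ 3 ∷ 9 ∷ 16 ∷ 17 ∷ 21 ∷ 28 ∷ []) ∷
      (1 ∷ 9 ∷ 11 ∷ 17 ∷ 23 ∷ 25 ∷ 28 ∷ []) ∷
      (5 ∷ 6 ∷ 9 ∷ 11 ∷ 14 ∷ 20 ∷ 27 ∷ []) ∷
      []
  }

graph5-9 : Certificate (2 ^ 5)
graph5-9 = record
  { root       = # 0
  ; parents    = # 0 ∷ # 0 ∷ # 0 ∷ # 0 ∷ # 7 ∷ # 0 ∷ # 2 ∷ # 0 ∷ # 9 ∷ # 0 ∷ # 0 ∷ # 1 ∷ # 5 ∷
      # 1 ∷ # 0 ∷ # 0 ∷ # 1 ∷ # 9 ∷ # 14 ∷ # 7 ∷ # 1 ∷ # 11 ∷ # 5 ∷ # 1 ∷ # 2 ∷ # 2 ∷ # 13 ∷ # 10 ∷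
      # 1 ∷ # 15 ∷ # 3 ∷ # 11 ∷ []
  ; neighbours =
      (1 ∷ 2 ∷ 3 ∷ 5 ∷ 7 ∷ 9 ∷ 10 ∷ 14 ∷ 15 ∷ []) ∷
      (0 ∷ 7 ∷ 11 ∷ 13 ∷ 14 ∷ 16 ∷ 20 ∷ 23 ∷ 28 ∷ []) ∷
      (0 ∷ 6 ∷ 7 ∷ 9 ∷ 13 ∷ 16 ∷ 20 ∷ 24 ∷ 25 ∷ []) ∷
      (0 ∷ 6 ∷ 9 ∷ 11 ∷ 14 ∷ 16 ∷ 24 ∷ 28 ∷ 30 ∷ []) ∷
      (7 ∷ 9 ∷ 10 ∷ 19 ∷ 20 ∷ 21 ∷ 23 ∷ 28 ∷ 29 ∷ []) ∷
      (0 ∷ 6 ∷ 7 ∷ 12 ∷ 14 ∷ 20 ∷ 22 ∷ 24 ∷ 25 ∷ []) ∷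
      (2 ∷ 3 ∷ 5 ∷ 18 ∷ 22 ∷ 25 ∷ 26 ∷ 28 ∷ 31 ∷ []) ∷
      (0 ∷ 1 ∷ 2 ∷ 4 ∷ 5 ∷ 10 ∷ 12 ∷ 19 ∷ 23 ∷ []) ∷
      (9 ∷ 14 ∷ 15 ∷ 17 ∷ 20 ∷ 22 ∷ 24 ∷ 25 ∷ 26 ∷ []) ∷
      (0 ∷ 2 ∷ 3 ∷ 4 ∷ 8 ∷ 10 ∷ 15 ∷ 17 ∷ 25 ∷ []) ∷
      (0 ∷ 4 ∷ 7 ∷ 9 ∷ 11 ∷ 24 ∷ 27 ∷ 28 ∷ 30 ∷ []) ∷
      (1 ∷ 3 ∷ 10 ∷ 19 ∷ 20 ∷ 21 ∷ 27 ∷ 30 ∷ 31 ∷ []) ∷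
      (5 ∷ 7 ∷ 14 ∷ 18 ∷ 24 ∷ 27 ∷ 28 ∷ 30 ∷ 31 ∷ []) ∷
      (1 ∷ 2 ∷ 15 ∷ 17 ∷ 21 ∷ 23 ∷ 24 ∷ 26 ∷ 29 ∷ []) ∷
      (0 ∷ 1 ∷ 3 ∷ 5 ∷ 8 ∷ 12 ∷ 15 ∷ 18 ∷ 30 ∷ []) ∷
      (0 ∷ 8 ∷ 9 ∷ 13 ∷ 14 ∷ 20 ∷ 23 ∷ 28 ∷ 29 ∷ []) ∷
      (1 ∷ 2 ∷ 3 ∷ 20 ∷ 22 ∷ 24 ∷ 27 ∷ 28 ∷ 29 ∷ []) ∷
      (8 ∷ 9 ∷ 13 ∷ 21 ∷ 22 ∷ 23 ∷ 25 ∷ 26 ∷ 27 ∷ []) ∷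
      (6 ∷ 12 ∷ 14 ∷ 25 ∷ 26 ∷ 27 ∷ 29 ∷ 30 ∷ 31 ∷ []) ∷
      (4 ∷ 7 ∷ 11 ∷ 21 ∷ 22 ∷ 23 ∷ 29 ∷ 30 ∷ 31 ∷ []) ∷
      (1 ∷ 2 ∷ 4 ∷ 5 ∷ 8 ∷ 11 ∷ 15 ∷ 16 ∷ 30 ∷ []) ∷
      (4 ∷ 11 ∷ 13 ∷ 17 ∷ 19 ∷ 26 ∷ 27 ∷ 30 ∷ 31 ∷ []) ∷
      (5 ∷ 6 ∷ 8 ∷ 16 ∷ 17 ∷ 19 ∷ 27 ∷ 29 ∷ 31 ∷ []) ∷
      (1 ∷ 4 ∷ 7 ∷ 13 ∷ 15 ∷ 17 ∷ 19 ∷ 24 ∷ 26 ∷ []) ∷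
      (2 ∷ 3 ∷ 5 ∷ 8 ∷ 10 ∷ 12 ∷ 13 ∷ 16 ∷ 23 ∷ []) ∷
      (2 ∷ 5 ∷ 6 ∷ 8 ∷ 9 ∷ 17 ∷ 18 ∷ 28 ∷ 31 ∷ []) ∷
      (6 ∷ 8 ∷ 13 ∷ 17 ∷ 18 ∷ 21 ∷ 23 ∷ 29 ∷ 31 ∷ []) ∷
      (10 ∷ 11 ∷ 12 ∷ 16 ∷ 17 ∷ 18 ∷ 21 ∷ 22 ∷ 29 ∷ []) ∷
      (1 ∷ 3 ∷ 4 ∷ 6 ∷ 10 ∷ 12 ∷ 15 ∷ 16 ∷ 25 ∷ []) ∷
      (4 ∷ 13 ∷ 15 ∷ 16 ∷ 18 ∷ 19 ∷ 22 ∷ 26 ∷ 27 ∷ []) ∷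
      (3 ∷ 10 ∷ 11 ∷ 12 ∷ 14 ∷ 18 ∷ 19 ∷ 20 ∷ 21 ∷ []) ∷
      (6 ∷ 11 ∷ 12 ∷ 18 ∷ 19 ∷ 21 ∷ 22 ∷ 25 ∷ 26 ∷ []) ∷
      []
  }

graph5-11 : Certificate (2 ^ 5)
graph5-11 = record
  { root       = # 0
  ; parents    = # 0 ∷ # 4 ∷ # 14 ∷ # 9 ∷ # 0 ∷ # 0 ∷ # 0 ∷ # 6 ∷ # 5 ∷ # 0 ∷ # 4 ∷ # 4 ∷ # 5 ∷
      # 5 ∷ # 0 ∷ # 4 ∷ # 0 ∷ # 0 ∷ # 4 ∷ # 6 ∷ # 6 ∷ # 14 ∷ # 5 ∷ # 14 ∷ # 0 ∷ # 4 ∷ # 0 ∷ # 5 ∷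
      # 0 ∷ # 9 ∷ # 9 ∷ # 0 ∷ []
  ; neighbours =
      (4 ∷ 5 ∷ 6 ∷ 9 ∷ 14 ∷ 16 ∷ 17 ∷ 24 ∷ 26 ∷ 28 ∷ 31 ∷ []) ∷
      (4 ∷ 5 ∷ 6 ∷ 16 ∷ 18 ∷ 19 ∷ 21 ∷ 22 ∷ 23 ∷ 29 ∷ 31 ∷ []) ∷
      (7 ∷ 11 ∷ 14 ∷ 16 ∷ 18 ∷ 19 ∷ 20 ∷ 24 ∷ 25 ∷ 26 ∷ 28 ∷ []) ∷
      (7 ∷ 9 ∷ 13 ∷ 16 ∷ 19 ∷ 20 ∷ 22 ∷ 26 ∷ 27 ∷ 28 ∷ 31 ∷ []) ∷
      (0 ∷ 1 ∷ 6 ∷ 9 ∷ 10 ∷ 11 ∷ 15 ∷ 17 ∷ 18 ∷ 25 ∷ 26 ∷ []) ∷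
      (0 ∷ 1 ∷ 6 ∷ 8 ∷ 12 ∷ 13 ∷ 14 ∷ 17 ∷ 22 ∷ 27 ∷ 28 ∷ []) ∷
      (0 ∷ 1 ∷ 4 ∷ 5 ∷ 7 ∷ 8 ∷ 15 ∷ 19 ∷ 20 ∷ 24 ∷ 31 ∷ []) ∷
      (2 ∷ 3 ∷ 6 ∷ 16 ∷ 17 ∷ 21 ∷ 23 ∷ 24 ∷ 29 ∷ 30 ∷ 31 ∷ []) ∷
      (5 ∷ 6 ∷ 14 ∷ 16 ∷ 17 ∷ 18 ∷ 19 ∷ 21 ∷ 27 ∷ 29 ∷ 30 ∷ []) ∷
      (0 ∷ 3 ∷ 4 ∷ 10 ∷ 12 ∷ 14 ∷ 15 ∷ 28 ∷ 29 ∷ 30 ∷ 31 ∷ []) ∷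
      (4 ∷ 9 ∷ 14 ∷ 16 ∷ 19 ∷ 20 ∷ 23 ∷ 25 ∷ 27 ∷ 28 ∷ 29 ∷ []) ∷
      (2 ∷ 4 ∷ 13 ∷ 16 ∷ 17 ∷ 21 ∷ 22 ∷ 23 ∷ 26 ∷ 27 ∷ 31 ∷ []) ∷
      (5 ∷ 9 ∷ 14 ∷ 16 ∷ 18 ∷ 19 ∷ 23 ∷ 24 ∷ 25 ∷ 27 ∷ 30 ∷ []) ∷
      (3 ∷ 5 ∷ 11 ∷ 16 ∷ 17 ∷ 18 ∷ 24 ∷ 25 ∷ 28 ∷ 29 ∷ 30 ∷ []) ∷
      (0 ∷ 2 ∷ 5 ∷ 8 ∷ 9 ∷ 10 ∷ 12 ∷ 21 ∷ 23 ∷ 24 ∷ 26 ∷ []) ∷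
      (4 ∷ 6 ∷ 9 ∷ 16 ∷ 18 ∷ 20 ∷ 22 ∷ 23 ∷ 26 ∷ 27 ∷ 29 ∷ []) ∷
      (0 ∷ 1 ∷ 2 ∷ 3 ∷ 7 ∷ 8 ∷ 10 ∷ 11 ∷ 12 ∷ 13 ∷ 15 ∷ []) ∷
      (0 ∷ 4 ∷ 5 ∷ 7 ∷ 8 ∷ 11 ∷ 13 ∷ 19 ∷ 21 ∷ 23 ∷ 25 ∷ []) ∷
      (1 ∷ 2 ∷ 4 ∷ 8 ∷ 12 ∷ 13 ∷ 15 ∷ 20 ∷ 22 ∷ 28 ∷ 31 ∷ []) ∷
      (1 ∷ 2 ∷ 3 ∷ 6 ∷ 8 ∷ 10 ∷ 12 ∷ 17 ∷ 21 ∷ 22 ∷ 26 ∷ []) ∷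
      (2 ∷ 3 ∷ 6 ∷ 10 ∷ 15 ∷ 18 ∷ 22 ∷ 24 ∷ 25 ∷ 26 ∷ 29 ∷ []) ∷
      (1 ∷ 7 ∷ 8 ∷ 11 ∷ 14 ∷ 17 ∷ 19 ∷ 22 ∷ 26 ∷ 27 ∷ 30 ∷ []) ∷
      (1 ∷ 3 ∷ 5 ∷ 11 ∷ 15 ∷ 18 ∷ 19 ∷ 20 ∷ 21 ∷ 28 ∷ 31 ∷ []) ∷
      (1 ∷ 7 ∷ 10 ∷ 11 ∷ 12 ∷ 14 ∷ 15 ∷ 17 ∷ 25 ∷ 28 ∷ 30 ∷ []) ∷
      (0 ∷ 2 ∷ 6 ∷ 7 ∷ 12 ∷ 13 ∷ 14 ∷ 20 ∷ 27 ∷ 29 ∷ 30 ∷ []) ∷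
      (2 ∷ 4 ∷ 10 ∷ 12 ∷ 13 ∷ 17 ∷ 20 ∷ 23 ∷ 28 ∷ 29 ∷ 30 ∷ []) ∷
      (0 ∷ 2 ∷ 3 ∷ 4 ∷ 11 ∷ 14 ∷ 15 ∷ 19 ∷ 20 ∷ 21 ∷ 29 ∷ []) ∷
      (3 ∷ 5 ∷ 8 ∷ 10 ∷ 11 ∷ 12 ∷ 15 ∷ 21 ∷ 24 ∷ 30 ∷ 31 ∷ []) ∷
      (0 ∷ 2 ∷ 3 ∷ 5 ∷ 9 ∷ 10 ∷ 13 ∷ 18 ∷ 22 ∷ 23 ∷ 25 ∷ []) ∷
      (1 ∷ 7 ∷ 8 ∷ 9 ∷ 10 ∷ 13 ∷ 15 ∷ 20 ∷ 24 ∷ 25 ∷ 26 ∷ []) ∷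
      (7 ∷ 8 ∷ 9 ∷ 12 ∷ 13 ∷ 21 ∷ 23 ∷ 24 ∷ 25 ∷ 27 ∷ 31 ∷ []) ∷
      (0 ∷ 1 ∷ 3 ∷ 6 ∷ 7 ∷ 9 ∷ 11 ∷ 18 ∷ 22 ∷ 27 ∷ 30 ∷ []) ∷
      []
  }

graph5-13 : Certificate (2 ^ 5)
graph5-13 = record
  { root       = # 0
  ; parents    = # 0 ∷ # 0 ∷ # 0 ∷ # 0 ∷ # 1 ∷ # 0 ∷ # 0 ∷ # 2 ∷ # 2 ∷ # 3 ∷ # 0 ∷ # 0 ∷ # 3 ∷
      # 0 ∷ # 1 ∷ # 0 ∷ # 0 ∷ # 0 ∷ # 0 ∷ # 0 ∷ # 15 ∷ # 2 ∷ # 1 ∷ # 1 ∷ # 5 ∷ # 1 ∷ # 1 ∷ # 1 ∷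
      # 10 ∷ # 2 ∷ # 1 ∷ # 1 ∷ []
  ; neighbours =
      (1 ∷ 2 ∷ 3 ∷ 5 ∷ 6 ∷ 10 ∷ 11 ∷ 13 ∷ 15 ∷ 16 ∷ 17 ∷ 18 ∷ 19 ∷ []) ∷
      (0 ∷ 2 ∷ 3 ∷ 4 ∷ 14 ∷ 19 ∷ 22 ∷ 23 ∷ 25 ∷ 26 ∷ 27 ∷ 30 ∷ 31 ∷ []) ∷
      (0 ∷ 1 ∷ 3 ∷ 7 ∷ 8 ∷ 17 ∷ 21 ∷ 23 ∷ 25 ∷ 27 ∷ 29 ∷ 30 ∷ 31 ∷ []) ∷
      (0 ∷ 1 ∷ 2 ∷ 9 ∷ 12 ∷ 18 ∷ 21 ∷ 22 ∷ 23 ∷ 25 ∷ 26 ∷ 29 ∷ 30 ∷ []) ∷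
      (1 ∷ 8 ∷ 10 ∷ 11 ∷ 12 ∷ 14 ∷ 15 ∷ 19 ∷ 20 ∷ 24 ∷ 25 ∷ 28 ∷ 31 ∷ []) ∷
      (0 ∷ 7 ∷ 8 ∷ 9 ∷ 10 ∷ 12 ∷ 13 ∷ 14 ∷ 15 ∷ 22 ∷ 24 ∷ 25 ∷ 27 ∷ []) ∷
      (0 ∷ 10 ∷ 11 ∷ 12 ∷ 13 ∷ 16 ∷ 17 ∷ 18 ∷ 19 ∷ 25 ∷ 27 ∷ 29 ∷ 31 ∷ []) ∷
      (2 ∷ 5 ∷ 8 ∷ 10 ∷ 15 ∷ 16 ∷ 17 ∷ 20 ∷ 21 ∷ 22 ∷ 25 ∷ 26 ∷ 31 ∷ []) ∷
      (2 ∷ 4 ∷ 5 ∷ 7 ∷ 12 ∷ 13 ∷ 15 ∷ 17 ∷ 20 ∷ 21 ∷ 24 ∷ 28 ∷ 30 ∷ []) ∷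
      (3 ∷ 5 ∷ 10 ∷ 12 ∷ 15 ∷ 16 ∷ 18 ∷ 21 ∷ 24 ∷ 26 ∷ 27 ∷ 30 ∷ 31 ∷ []) ∷
      (0 ∷ 4 ∷ 5 ∷ 6 ∷ 7 ∷ 9 ∷ 12 ∷ 14 ∷ 15 ∷ 27 ∷ 28 ∷ 29 ∷ 30 ∷ []) ∷
      (0 ∷ 4 ∷ 6 ∷ 13 ∷ 15 ∷ 16 ∷ 17 ∷ 18 ∷ 19 ∷ 21 ∷ 22 ∷ 29 ∷ 30 ∷ []) ∷
      (3 ∷ 4 ∷ 5 ∷ 6 ∷ 8 ∷ 9 ∷ 10 ∷ 18 ∷ 20 ∷ 23 ∷ 24 ∷ 26 ∷ 28 ∷ []) ∷
      (0 ∷ 5 ∷ 6 ∷ 8 ∷ 11 ∷ 16 ∷ 17 ∷ 18 ∷ 19 ∷ 22 ∷ 23 ∷ 26 ∷ 27 ∷ []) ∷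
      (1 ∷ 4 ∷ 5 ∷ 10 ∷ 15 ∷ 16 ∷ 19 ∷ 21 ∷ 23 ∷ 26 ∷ 28 ∷ 29 ∷ 31 ∷ []) ∷
      (0 ∷ 4 ∷ 5 ∷ 7 ∷ 8 ∷ 9 ∷ 10 ∷ 11 ∷ 14 ∷ 20 ∷ 22 ∷ 23 ∷ 29 ∷ []) ∷
      (0 ∷ 6 ∷ 7 ∷ 9 ∷ 11 ∷ 13 ∷ 14 ∷ 20 ∷ 22 ∷ 24 ∷ 27 ∷ 28 ∷ 29 ∷ []) ∷
      (0 ∷ 2 ∷ 6 ∷ 7 ∷ 8 ∷ 11 ∷ 13 ∷ 18 ∷ 19 ∷ 21 ∷ 26 ∷ 29 ∷ 30 ∷ []) ∷
      (0 ∷ 3 ∷ 6 ∷ 9 ∷ 11 ∷ 12 ∷ 13 ∷ 17 ∷ 19 ∷ 22 ∷ 23 ∷ 26 ∷ 31 ∷ []) ∷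
      (0 ∷ 1 ∷ 4 ∷ 6 ∷ 11 ∷ 13 ∷ 14 ∷ 17 ∷ 18 ∷ 21 ∷ 25 ∷ 27 ∷ 31 ∷ []) ∷
      (4 ∷ 7 ∷ 8 ∷ 12 ∷ 15 ∷ 16 ∷ 22 ∷ 23 ∷ 24 ∷ 25 ∷ 27 ∷ 28 ∷ 31 ∷ []) ∷
      (2 ∷ 3 ∷ 7 ∷ 8 ∷ 9 ∷ 11 ∷ 14 ∷ 17 ∷ 19 ∷ 24 ∷ 26 ∷ 29 ∷ 31 ∷ []) ∷
      (1 ∷ 3 ∷ 5 ∷ 7 ∷ 11 ∷ 13 ∷ 15 ∷ 16 ∷ 18 ∷ 20 ∷ 25 ∷ 26 ∷ 28 ∷ []) ∷
      (1 ∷ 2 ∷ 3 ∷ 12 ∷ 13 ∷ 14 ∷ 15 ∷ 18 ∷ 20 ∷ 25 ∷ 28 ∷ 29 ∷ 30 ∷ []) ∷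
      (4 ∷ 5 ∷ 8 ∷ 9 ∷ 12 ∷ 16 ∷ 20 ∷ 21 ∷ 25 ∷ 27 ∷ 28 ∷ 29 ∷ 30 ∷ []) ∷
      (1 ∷ 2 ∷ 3 ∷ 4 ∷ 5 ∷ 6 ∷ 7 ∷ 19 ∷ 20 ∷ 22 ∷ 23 ∷ 24 ∷ 30 ∷ []) ∷
      (1 ∷ 3 ∷ 7 ∷ 9 ∷ 12 ∷ 13 ∷ 14 ∷ 17 ∷ 18 ∷ 21 ∷ 22 ∷ 28 ∷ 31 ∷ []) ∷
      (1 ∷ 2 ∷ 5 ∷ 6 ∷ 9 ∷ 10 ∷ 13 ∷ 16 ∷ 19 ∷ 20 ∷ 24 ∷ 30 ∷ 31 ∷ []) ∷
      (4 ∷ 8 ∷ 10 ∷ 12 ∷ 14 ∷ 16 ∷ 20 ∷ 22 ∷ 23 ∷ 24 ∷ 26 ∷ 29 ∷ 30 ∷ []) ∷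
      (2 ∷ 3 ∷ 6 ∷ 10 ∷ 11 ∷ 14 ∷ 15 ∷ 16 ∷ 17 ∷ 21 ∷ 23 ∷ 24 ∷ 28 ∷ []) ∷
      (1 ∷ 2 ∷ 3 ∷ 8 ∷ 9 ∷ 10 ∷ 11 ∷ 17 ∷ 23 ∷ 24 ∷ 25 ∷ 27 ∷ 28 ∷ []) ∷
      (1 ∷ 2 ∷ 4 ∷ 6 ∷ 7 ∷ 9 ∷ 14 ∷ 18 ∷ 19 ∷ 20 ∷ 21 ∷ 26 ∷ 27 ∷ []) ∷
      []
  }

graph5-15 : Certificate (2 ^ 5)
graph5-15 = record
  { root       = # 0
  ; parents    = # 0 ∷ # 3 ∷ # 0 ∷ # 0 ∷ # 17 ∷ # 17 ∷ # 18 ∷ # 0 ∷ # 7 ∷ # 18 ∷ # 2 ∷ # 0 ∷ # 7 ∷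
      # 0 ∷ # 17 ∷ # 2 ∷ # 2 ∷ # 0 ∷ # 0 ∷ # 0 ∷ # 3 ∷ # 7 ∷ # 11 ∷ # 0 ∷ # 0 ∷ # 2 ∷ # 0 ∷ # 0 ∷
      # 0 ∷ # 0 ∷ # 13 ∷ # 0 ∷ []
  ; neighbours =
      (2 ∷ 3 ∷ 7 ∷ 11 ∷ 13 ∷ 17 ∷ 18 ∷ 19 ∷ 23 ∷ 24 ∷ 26 ∷ 27 ∷ 28 ∷ 29 ∷ 31 ∷ []) ∷
      (3 ∷ 4 ∷ 5 ∷ 6 ∷ 9 ∷ 11 ∷ 14 ∷ 18 ∷ 19 ∷ 20 ∷ 22 ∷ 23 ∷ 29 ∷ 30 ∷ 31 ∷ []) ∷
      (0 ∷ 3 ∷ 7 ∷ 10 ∷ 11 ∷ 13 ∷ 15 ∷ 16 ∷ 17 ∷ 18 ∷ 19 ∷ 24 ∷ 25 ∷ 26 ∷ 28 ∷ []) ∷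
      (0 ∷ 1 ∷ 2 ∷ 7 ∷ 11 ∷ 13 ∷ 15 ∷ 16 ∷ 19 ∷ 20 ∷ 24 ∷ 26 ∷ 27 ∷ 28 ∷ 31 ∷ []) ∷
      (1 ∷ 8 ∷ 10 ∷ 12 ∷ 15 ∷ 17 ∷ 18 ∷ 19 ∷ 20 ∷ 22 ∷ 23 ∷ 26 ∷ 28 ∷ 29 ∷ 30 ∷ []) ∷
      (1 ∷ 8 ∷ 10 ∷ 12 ∷ 15 ∷ 17 ∷ 18 ∷ 19 ∷ 20 ∷ 21 ∷ 23 ∷ 27 ∷ 28 ∷ 30 ∷ 31 ∷ []) ∷
      (1 ∷ 8 ∷ 10 ∷ 12 ∷ 15 ∷ 18 ∷ 19 ∷ 21 ∷ 22 ∷ 24 ∷ 25 ∷ 26 ∷ 27 ∷ 29 ∷ 31 ∷ []) ∷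
      (0 ∷ 2 ∷ 3 ∷ 8 ∷ 11 ∷ 12 ∷ 13 ∷ 16 ∷ 17 ∷ 21 ∷ 23 ∷ 24 ∷ 26 ∷ 29 ∷ 31 ∷ []) ∷
      (4 ∷ 5 ∷ 6 ∷ 7 ∷ 9 ∷ 11 ∷ 14 ∷ 17 ∷ 18 ∷ 19 ∷ 21 ∷ 22 ∷ 25 ∷ 27 ∷ 29 ∷ []) ∷
      (1 ∷ 8 ∷ 10 ∷ 12 ∷ 15 ∷ 18 ∷ 20 ∷ 21 ∷ 23 ∷ 24 ∷ 25 ∷ 27 ∷ 28 ∷ 29 ∷ 31 ∷ []) ∷
      (2 ∷ 4 ∷ 5 ∷ 6 ∷ 9 ∷ 13 ∷ 14 ∷ 19 ∷ 22 ∷ 23 ∷ 25 ∷ 27 ∷ 28 ∷ 29 ∷ 30 ∷ []) ∷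
      (0 ∷ 1 ∷ 2 ∷ 3 ∷ 7 ∷ 8 ∷ 13 ∷ 16 ∷ 17 ∷ 22 ∷ 23 ∷ 26 ∷ 27 ∷ 28 ∷ 31 ∷ []) ∷
      (4 ∷ 5 ∷ 6 ∷ 7 ∷ 9 ∷ 13 ∷ 14 ∷ 18 ∷ 19 ∷ 20 ∷ 21 ∷ 23 ∷ 24 ∷ 27 ∷ 30 ∷ []) ∷
      (0 ∷ 2 ∷ 3 ∷ 7 ∷ 10 ∷ 11 ∷ 12 ∷ 16 ∷ 17 ∷ 18 ∷ 24 ∷ 28 ∷ 29 ∷ 30 ∷ 31 ∷ []) ∷
      (1 ∷ 8 ∷ 10 ∷ 12 ∷ 15 ∷ 17 ∷ 19 ∷ 22 ∷ 23 ∷ 24 ∷ 25 ∷ 26 ∷ 27 ∷ 29 ∷ 30 ∷ []) ∷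
      (2 ∷ 3 ∷ 4 ∷ 5 ∷ 6 ∷ 9 ∷ 14 ∷ 18 ∷ 20 ∷ 21 ∷ 23 ∷ 25 ∷ 26 ∷ 27 ∷ 29 ∷ []) ∷
      (2 ∷ 3 ∷ 7 ∷ 11 ∷ 13 ∷ 17 ∷ 20 ∷ 21 ∷ 22 ∷ 24 ∷ 25 ∷ 26 ∷ 28 ∷ 30 ∷ 31 ∷ []) ∷
      (0 ∷ 2 ∷ 4 ∷ 5 ∷ 7 ∷ 8 ∷ 11 ∷ 13 ∷ 14 ∷ 16 ∷ 20 ∷ 21 ∷ 23 ∷ 25 ∷ 27 ∷ []) ∷
      (0 ∷ 1 ∷ 2 ∷ 4 ∷ 5 ∷ 6 ∷ 8 ∷ 9 ∷ 12 ∷ 13 ∷ 15 ∷ 20 ∷ 25 ∷ 26 ∷ 28 ∷ []) ∷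
      (0 ∷ 1 ∷ 2 ∷ 3 ∷ 4 ∷ 5 ∷ 6 ∷ 8 ∷ 10 ∷ 12 ∷ 14 ∷ 20 ∷ 22 ∷ 26 ∷ 31 ∷ []) ∷
      (1 ∷ 3 ∷ 4 ∷ 5 ∷ 9 ∷ 12 ∷ 15 ∷ 16 ∷ 17 ∷ 18 ∷ 19 ∷ 21 ∷ 24 ∷ 26 ∷ 30 ∷ []) ∷
      (5 ∷ 6 ∷ 7 ∷ 8 ∷ 9 ∷ 12 ∷ 15 ∷ 16 ∷ 17 ∷ 20 ∷ 23 ∷ 25 ∷ 26 ∷ 27 ∷ 28 ∷ []) ∷
      (1 ∷ 4 ∷ 6 ∷ 8 ∷ 10 ∷ 11 ∷ 14 ∷ 16 ∷ 19 ∷ 24 ∷ 25 ∷ 27 ∷ 28 ∷ 30 ∷ 31 ∷ []) ∷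
      (0 ∷ 1 ∷ 4 ∷ 5 ∷ 7 ∷ 9 ∷ 10 ∷ 11 ∷ 12 ∷ 14 ∷ 15 ∷ 17 ∷ 21 ∷ 24 ∷ 30 ∷ []) ∷
      (0 ∷ 2 ∷ 3 ∷ 6 ∷ 7 ∷ 9 ∷ 12 ∷ 13 ∷ 14 ∷ 16 ∷ 20 ∷ 22 ∷ 23 ∷ 29 ∷ 30 ∷ []) ∷
      (2 ∷ 6 ∷ 8 ∷ 9 ∷ 10 ∷ 14 ∷ 15 ∷ 16 ∷ 17 ∷ 18 ∷ 21 ∷ 22 ∷ 28 ∷ 29 ∷ 31 ∷ []) ∷
      (0 ∷ 2 ∷ 3 ∷ 4 ∷ 6 ∷ 7 ∷ 11 ∷ 14 ∷ 15 ∷ 16 ∷ 18 ∷ 19 ∷ 20 ∷ 21 ∷ 30 ∷ []) ∷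
      (0 ∷ 3 ∷ 5 ∷ 6 ∷ 8 ∷ 9 ∷ 10 ∷ 11 ∷ 12 ∷ 14 ∷ 15 ∷ 17 ∷ 21 ∷ 22 ∷ 31 ∷ []) ∷
      (0 ∷ 2 ∷ 3 ∷ 4 ∷ 5 ∷ 9 ∷ 10 ∷ 11 ∷ 13 ∷ 16 ∷ 18 ∷ 21 ∷ 22 ∷ 25 ∷ 29 ∷ []) ∷
      (0 ∷ 1 ∷ 4 ∷ 6 ∷ 7 ∷ 8 ∷ 9 ∷ 10 ∷ 13 ∷ 14 ∷ 15 ∷ 24 ∷ 25 ∷ 28 ∷ 30 ∷ []) ∷
      (1 ∷ 4 ∷ 5 ∷ 10 ∷ 12 ∷ 13 ∷ 14 ∷ 16 ∷ 20 ∷ 22 ∷ 23 ∷ 24 ∷ 26 ∷ 29 ∷ 31 ∷ []) ∷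
      (0 ∷ 1 ∷ 3 ∷ 5 ∷ 6 ∷ 7 ∷ 9 ∷ 11 ∷ 13 ∷ 16 ∷ 19 ∷ 22 ∷ 25 ∷ 27 ∷ 30 ∷ []) ∷
      []
  }

graph5-27 : Certificate (2 ^ 5)
graph5-27 = record
  { root       = # 0
  ; parents    = # 0 ∷ # 0 ∷ # 0 ∷ # 0 ∷ # 0 ∷ # 0 ∷ # 0 ∷ # 0 ∷ # 0 ∷ # 0 ∷ # 0 ∷ # 0 ∷ # 0 ∷
      # 0 ∷ # 0 ∷ # 0 ∷ # 1 ∷ # 0 ∷ # 0 ∷ # 0 ∷ # 0 ∷ # 0 ∷ # 0 ∷ # 1 ∷ # 0 ∷ # 1 ∷ # 0 ∷ # 0 ∷
      # 0 ∷ # 0 ∷ # 1 ∷ # 0 ∷ []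
  ; neighbours =
      (1 ∷ 2 ∷ 3 ∷ 4 ∷ 5 ∷ 6 ∷ 7 ∷ 8 ∷ 9 ∷ 10 ∷ 11 ∷ 12 ∷ 13 ∷ 14 ∷ 15 ∷ 17 ∷ 18 ∷ 19 ∷ 20 ∷ 21 ∷ 22 ∷ 24 ∷ 26 ∷ 27 ∷ 28 ∷ 29 ∷ 31 ∷ []) ∷
      (0 ∷ 2 ∷ 3 ∷ 4 ∷ 5 ∷ 6 ∷ 7 ∷ 8 ∷ 9 ∷ 11 ∷ 13 ∷ 14 ∷ 15 ∷ 16 ∷ 17 ∷ 18 ∷ 19 ∷ 20 ∷ 21 ∷ 22 ∷ 23 ∷ 25 ∷ 26 ∷ 27 ∷ 28 ∷ 29 ∷ 30 ∷ []) ∷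
      (0 ∷ 1 ∷ 3 ∷ 5 ∷ 6 ∷ 7 ∷ 8 ∷ 9 ∷ 10 ∷ 11 ∷ 12 ∷ 13 ∷ 14 ∷ 16 ∷ 17 ∷ 18 ∷ 19 ∷ 20 ∷ 22 ∷ 23 ∷ 24 ∷ 25 ∷ 26 ∷ 27 ∷ 29 ∷ 30 ∷ 31 ∷ []) ∷
      (0 ∷ 1 ∷ 2 ∷ 4 ∷ 6 ∷ 7 ∷ 9 ∷ 10 ∷ 11 ∷ 12 ∷ 13 ∷ 14 ∷ 15 ∷ 16 ∷ 17 ∷ 18 ∷ 19 ∷ 21 ∷ 22 ∷ 23 ∷ 24 ∷ 25 ∷ 27 ∷ 28 ∷ 29 ∷ 30 ∷ 31 ∷ []) ∷
      (0 ∷ 1 ∷ 3 ∷ 5 ∷ 6 ∷ 7 ∷ 8 ∷ 9 ∷ 11 ∷ 12 ∷ 13 ∷ 14 ∷ 15 ∷ 16 ∷ 17 ∷ 19 ∷ 20 ∷ 21 ∷ 22 ∷ 23 ∷ 24 ∷ 25 ∷ 26 ∷ 27 ∷ 28 ∷ 29 ∷ 31 ∷ []) ∷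
      (0 ∷ 1 ∷ 2 ∷ 4 ∷ 6 ∷ 7 ∷ 8 ∷ 9 ∷ 10 ∷ 11 ∷ 13 ∷ 14 ∷ 15 ∷ 16 ∷ 18 ∷ 19 ∷ 20 ∷ 21 ∷ 22 ∷ 23 ∷ 24 ∷ 25 ∷ 26 ∷ 28 ∷ 29 ∷ 30 ∷ 31 ∷ []) ∷
      (0 ∷ 1 ∷ 2 ∷ 3 ∷ 4 ∷ 5 ∷ 8 ∷ 10 ∷ 11 ∷ 12 ∷ 13 ∷ 14 ∷ 15 ∷ 16 ∷ 17 ∷ 18 ∷ 19 ∷ 21 ∷ 22 ∷ 23 ∷ 24 ∷ 25 ∷ 26 ∷ 27 ∷ 29 ∷ 30 ∷ 31 ∷ []) ∷
      (0 ∷ 1 ∷ 2 ∷ 3 ∷ 4 ∷ 5 ∷ 8 ∷ 9 ∷ 10 ∷ 11 ∷ 12 ∷ 14 ∷ 15 ∷ 16 ∷ 17 ∷ 19 ∷ 20 ∷ 21 ∷ 22 ∷ 23 ∷ 24 ∷ 25 ∷ 26 ∷ 27 ∷ 28 ∷ 29 ∷ 31 ∷ []) ∷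
      (0 ∷ 1 ∷ 2 ∷ 4 ∷ 5 ∷ 6 ∷ 7 ∷ 9 ∷ 10 ∷ 11 ∷ 12 ∷ 13 ∷ 14 ∷ 16 ∷ 17 ∷ 18 ∷ 20 ∷ 21 ∷ 22 ∷ 24 ∷ 25 ∷ 26 ∷ 27 ∷ 28 ∷ 29 ∷ 30 ∷ 31 ∷ []) ∷
      (0 ∷ 1 ∷ 2 ∷ 3 ∷ 4 ∷ 5 ∷ 7 ∷ 8 ∷ 10 ∷ 12 ∷ 13 ∷ 14 ∷ 15 ∷ 16 ∷ 17 ∷ 18 ∷ 20 ∷ 21 ∷ 22 ∷ 24 ∷ 25 ∷ 26 ∷ 27 ∷ 28 ∷ 29 ∷ 30 ∷ 31 ∷ []) ∷
      (0 ∷ 2 ∷ 3 ∷ 5 ∷ 6 ∷ 7 ∷ 8 ∷ 9 ∷ 11 ∷ 12 ∷ 13 ∷ 14 ∷ 15 ∷ 16 ∷ 17 ∷ 19 ∷ 20 ∷ 21 ∷ 22 ∷ 23 ∷ 24 ∷ 25 ∷ 26 ∷ 27 ∷ 28 ∷ 30 ∷ 31 ∷ []) ∷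
      (0 ∷ 1 ∷ 2 ∷ 3 ∷ 4 ∷ 5 ∷ 6 ∷ 7 ∷ 8 ∷ 10 ∷ 12 ∷ 13 ∷ 15 ∷ 16 ∷ 17 ∷ 18 ∷ 19 ∷ 21 ∷ 22 ∷ 23 ∷ 25 ∷ 26 ∷ 27 ∷ 28 ∷ 29 ∷ 30 ∷ 31 ∷ []) ∷
      (0 ∷ 2 ∷ 3 ∷ 4 ∷ 6 ∷ 7 ∷ 8 ∷ 9 ∷ 10 ∷ 11 ∷ 13 ∷ 14 ∷ 15 ∷ 16 ∷ 18 ∷ 19 ∷ 20 ∷ 21 ∷ 22 ∷ 23 ∷ 24 ∷ 26 ∷ 27 ∷ 28 ∷ 29 ∷ 30 ∷ 31 ∷ []) ∷
      (0 ∷ 1 ∷ 2 ∷ 3 ∷ 4 ∷ 5 ∷ 6 ∷ 8 ∷ 9 ∷ 10 ∷ 11 ∷ 12 ∷ 15 ∷ 16 ∷ 17 ∷ 18 ∷ 19 ∷ 20 ∷ 21 ∷ 22 ∷ 23 ∷ 25 ∷ 26 ∷ 27 ∷ 29 ∷ 30 ∷ 31 ∷ []) ∷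
      (0 ∷ 1 ∷ 2 ∷ 3 ∷ 4 ∷ 5 ∷ 6 ∷ 7 ∷ 8 ∷ 9 ∷ 10 ∷ 12 ∷ 15 ∷ 16 ∷ 18 ∷ 19 ∷ 20 ∷ 21 ∷ 22 ∷ 23 ∷ 24 ∷ 26 ∷ 27 ∷ 28 ∷ 29 ∷ 30 ∷ 31 ∷ []) ∷
      (0 ∷ 1 ∷ 3 ∷ 4 ∷ 5 ∷ 6 ∷ 7 ∷ 9 ∷ 10 ∷ 11 ∷ 12 ∷ 13 ∷ 14 ∷ 16 ∷ 17 ∷ 18 ∷ 20 ∷ 21 ∷ 23 ∷ 24 ∷ 25 ∷ 26 ∷ 27 ∷ 28 ∷ 29 ∷ 30 ∷ 31 ∷ []) ∷
      (1 ∷ 2 ∷ 3 ∷ 4 ∷ 5 ∷ 6 ∷ 7 ∷ 8 ∷ 9 ∷ 10 ∷ 11 ∷ 12 ∷ 13 ∷ 14 ∷ 15 ∷ 17 ∷ 18 ∷ 19 ∷ 20 ∷ 22 ∷ 23 ∷ 24 ∷ 25 ∷ 27 ∷ 28 ∷ 29 ∷ 30 ∷ []) ∷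
      (0 ∷ 1 ∷ 2 ∷ 3 ∷ 4 ∷ 6 ∷ 7 ∷ 8 ∷ 9 ∷ 10 ∷ 11 ∷ 13 ∷ 15 ∷ 16 ∷ 18 ∷ 19 ∷ 20 ∷ 21 ∷ 23 ∷ 24 ∷ 25 ∷ 26 ∷ 27 ∷ 28 ∷ 29 ∷ 30 ∷ 31 ∷ []) ∷
      (0 ∷ 1 ∷ 2 ∷ 3 ∷ 5 ∷ 6 ∷ 8 ∷ 9 ∷ 11 ∷ 12 ∷ 13 ∷ 14 ∷ 15 ∷ 16 ∷ 17 ∷ 19 ∷ 20 ∷ 21 ∷ 22 ∷ 23 ∷ 24 ∷ 25 ∷ 26 ∷ 28 ∷ 29 ∷ 30 ∷ 31 ∷ []) ∷
      (0 ∷ 1 ∷ 2 ∷ 3 ∷ 4 ∷ 5 ∷ 6 ∷ 7 ∷ 10 ∷ 11 ∷ 12 ∷ 13 ∷ 14 ∷ 16 ∷ 17 ∷ 18 ∷ 20 ∷ 21 ∷ 22 ∷ 23 ∷ 24 ∷ 25 ∷ 26 ∷ 27 ∷ 28 ∷ 30 ∷ 31 ∷ []) ∷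
      (0 ∷ 1 ∷ 2 ∷ 4 ∷ 5 ∷ 7 ∷ 8 ∷ 9 ∷ 10 ∷ 12 ∷ 13 ∷ 14 ∷ 15 ∷ 16 ∷ 17 ∷ 18 ∷ 19 ∷ 21 ∷ 22 ∷ 23 ∷ 24 ∷ 25 ∷ 27 ∷ 28 ∷ 29 ∷ 30 ∷ 31 ∷ []) ∷
      (0 ∷ 1 ∷ 3 ∷ 4 ∷ 5 ∷ 6 ∷ 7 ∷ 8 ∷ 9 ∷ 10 ∷ 11 ∷ 12 ∷ 13 ∷ 14 ∷ 15 ∷ 17 ∷ 18 ∷ 19 ∷ 20 ∷ 22 ∷ 23 ∷ 24 ∷ 25 ∷ 26 ∷ 29 ∷ 30 ∷ 31 ∷ []) ∷
      (0 ∷ 1 ∷ 2 ∷ 3 ∷ 4 ∷ 5 ∷ 6 ∷ 7 ∷ 8 ∷ 9 ∷ 10 ∷ 11 ∷ 12 ∷ 13 ∷ 14 ∷ 16 ∷ 18 ∷ 19 ∷ 20 ∷ 21 ∷ 24 ∷ 25 ∷ 26 ∷ 27 ∷ 28 ∷ 29 ∷ 30 ∷ []) ∷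
      (1 ∷ 2 ∷ 3 ∷ 4 ∷ 5 ∷ 6 ∷ 7 ∷ 10 ∷ 11 ∷ 12 ∷ 13 ∷ 14 ∷ 15 ∷ 16 ∷ 17 ∷ 18 ∷ 19 ∷ 20 ∷ 21 ∷ 24 ∷ 25 ∷ 26 ∷ 27 ∷ 28 ∷ 29 ∷ 30 ∷ 31 ∷ []) ∷
      (0 ∷ 2 ∷ 3 ∷ 4 ∷ 5 ∷ 6 ∷ 7 ∷ 8 ∷ 9 ∷ 10 ∷ 12 ∷ 14 ∷ 15 ∷ 16 ∷ 17 ∷ 18 ∷ 19 ∷ 20 ∷ 21 ∷ 22 ∷ 23 ∷ 25 ∷ 26 ∷ 27 ∷ 28 ∷ 29 ∷ 30 ∷ []) ∷
      (1 ∷ 2 ∷ 3 ∷ 4 ∷ 5 ∷ 6 ∷ 7 ∷ 8 ∷ 9 ∷ 10 ∷ 11 ∷ 13 ∷ 15 ∷ 16 ∷ 17 ∷ 18 ∷ 19 ∷ 20 ∷ 21 ∷ 22 ∷ 23 ∷ 24 ∷ 26 ∷ 28 ∷ 29 ∷ 30 ∷ 31 ∷ []) ∷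
      (0 ∷ 1 ∷ 2 ∷ 4 ∷ 5 ∷ 6 ∷ 7 ∷ 8 ∷ 9 ∷ 10 ∷ 11 ∷ 12 ∷ 13 ∷ 14 ∷ 15 ∷ 17 ∷ 18 ∷ 19 ∷ 21 ∷ 22 ∷ 23 ∷ 24 ∷ 25 ∷ 27 ∷ 28 ∷ 30 ∷ 31 ∷ []) ∷
      (0 ∷ 1 ∷ 2 ∷ 3 ∷ 4 ∷ 6 ∷ 7 ∷ 8 ∷ 9 ∷ 10 ∷ 11 ∷ 12 ∷ 13 ∷ 14 ∷ 15 ∷ 16 ∷ 17 ∷ 19 ∷ 20 ∷ 22 ∷ 23 ∷ 24 ∷ 26 ∷ 28 ∷ 29 ∷ 30 ∷ 31 ∷ []) ∷
      (0 ∷ 1 ∷ 3 ∷ 4 ∷ 5 ∷ 7 ∷ 8 ∷ 9 ∷ 10 ∷ 11 ∷ 12 ∷ 14 ∷ 15 ∷ 16 ∷ 17 ∷ 18 ∷ 19 ∷ 20 ∷ 22 ∷ 23 ∷ 24 ∷ 25 ∷ 26 ∷ 27 ∷ 29 ∷ 30 ∷ 31 ∷ []) ∷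
      (0 ∷ 1 ∷ 2 ∷ 3 ∷ 4 ∷ 5 ∷ 6 ∷ 7 ∷ 8 ∷ 9 ∷ 11 ∷ 12 ∷ 13 ∷ 14 ∷ 15 ∷ 16 ∷ 17 ∷ 18 ∷ 20 ∷ 21 ∷ 22 ∷ 23 ∷ 24 ∷ 25 ∷ 27 ∷ 28 ∷ 31 ∷ []) ∷
      (1 ∷ 2 ∷ 3 ∷ 5 ∷ 6 ∷ 8 ∷ 9 ∷ 10 ∷ 11 ∷ 12 ∷ 13 ∷ 14 ∷ 15 ∷ 16 ∷ 17 ∷ 18 ∷ 19 ∷ 20 ∷ 21 ∷ 22 ∷ 23 ∷ 24 ∷ 25 ∷ 26 ∷ 27 ∷ 28 ∷ 31 ∷ []) ∷
      (0 ∷ 2 ∷ 3 ∷ 4 ∷ 5 ∷ 6 ∷ 7 ∷ 8 ∷ 9 ∷ 10 ∷ 11 ∷ 12 ∷ 13 ∷ 14 ∷ 15 ∷ 17 ∷ 18 ∷ 19 ∷ 20 ∷ 21 ∷ 23 ∷ 25 ∷ 26 ∷ 27 ∷ 28 ∷ 29 ∷ 30 ∷ []) ∷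
      []
  }

graph6-9 : Certificate (2 ^ 6)
graph6-9 = record
  { root       = # 0
  ; parents    = # 0 ∷ # 29 ∷ # 38 ∷ # 59 ∷ # 38 ∷ # 11 ∷ # 0 ∷ # 56 ∷ # 59 ∷ # 28 ∷ # 13 ∷ # 0 ∷
      # 29 ∷ # 0 ∷ # 36 ∷ # 6 ∷ # 15 ∷ # 13 ∷ # 13 ∷ # 6 ∷ # 28 ∷ # 26 ∷ # 56 ∷ # 13 ∷ # 59 ∷
      # 59 ∷ # 11 ∷ # 30 ∷ # 0 ∷ # 0 ∷ # 6 ∷ # 6 ∷ # 19 ∷ # 11 ∷ # 6 ∷ # 6 ∷ # 0 ∷ # 11 ∷ # 0 ∷
      # 11 ∷ # 29 ∷ # 6 ∷ # 31 ∷ # 28 ∷ # 29 ∷ # 34 ∷ # 29 ∷ # 13 ∷ # 33 ∷ # 11 ∷ # 13 ∷ # 11 ∷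
      # 38 ∷ # 6 ∷ # 51 ∷ # 38 ∷ # 0 ∷ # 13 ∷ # 13 ∷ # 0 ∷ # 38 ∷ # 36 ∷ # 11 ∷ # 41 ∷ []
  ; neighbours =
      (6 ∷ 11 ∷ 13 ∷ 28 ∷ 29 ∷ 36 ∷ 38 ∷ 56 ∷ 59 ∷ []) ∷
      (2 ∷ 3 ∷ 9 ∷ 29 ∷ 30 ∷ 40 ∷ 42 ∷ 48 ∷ 57 ∷ []) ∷
      (1 ∷ 3 ∷ 14 ∷ 16 ∷ 30 ∷ 38 ∷ 39 ∷ 60 ∷ 63 ∷ []) ∷
      (1 ∷ 2 ∷ 7 ∷ 20 ∷ 21 ∷ 32 ∷ 39 ∷ 57 ∷ 59 ∷ []) ∷
      (10 ∷ 16 ∷ 26 ∷ 37 ∷ 38 ∷ 49 ∷ 51 ∷ 62 ∷ 63 ∷ []) ∷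
      (11 ∷ 12 ∷ 18 ∷ 32 ∷ 35 ∷ 36 ∷ 40 ∷ 46 ∷ 52 ∷ []) ∷
      (0 ∷ 15 ∷ 19 ∷ 30 ∷ 31 ∷ 34 ∷ 35 ∷ 41 ∷ 53 ∷ []) ∷
      (3 ∷ 9 ∷ 14 ∷ 16 ∷ 19 ∷ 22 ∷ 27 ∷ 50 ∷ 56 ∷ []) ∷
      (15 ∷ 17 ∷ 18 ∷ 21 ∷ 23 ∷ 32 ∷ 47 ∷ 58 ∷ 59 ∷ []) ∷
      (1 ∷ 7 ∷ 14 ∷ 19 ∷ 28 ∷ 32 ∷ 33 ∷ 43 ∷ 45 ∷ []) ∷
      (4 ∷ 13 ∷ 24 ∷ 35 ∷ 48 ∷ 49 ∷ 55 ∷ 56 ∷ 60 ∷ []) ∷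
      (0 ∷ 5 ∷ 26 ∷ 33 ∷ 37 ∷ 39 ∷ 49 ∷ 51 ∷ 62 ∷ []) ∷
      (5 ∷ 29 ∷ 31 ∷ 34 ∷ 35 ∷ 41 ∷ 42 ∷ 48 ∷ 53 ∷ []) ∷
      (0 ∷ 10 ∷ 17 ∷ 18 ∷ 23 ∷ 47 ∷ 50 ∷ 57 ∷ 58 ∷ []) ∷
      (2 ∷ 7 ∷ 9 ∷ 33 ∷ 36 ∷ 48 ∷ 50 ∷ 54 ∷ 61 ∷ []) ∷
      (6 ∷ 8 ∷ 16 ∷ 18 ∷ 20 ∷ 25 ∷ 28 ∷ 44 ∷ 49 ∷ []) ∷
      (2 ∷ 4 ∷ 7 ∷ 15 ∷ 25 ∷ 32 ∷ 48 ∷ 50 ∷ 53 ∷ []) ∷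
      (8 ∷ 13 ∷ 20 ∷ 27 ∷ 30 ∷ 43 ∷ 56 ∷ 58 ∷ 61 ∷ []) ∷
      (5 ∷ 8 ∷ 13 ∷ 15 ∷ 25 ∷ 35 ∷ 40 ∷ 44 ∷ 49 ∷ []) ∷
      (6 ∷ 7 ∷ 9 ∷ 30 ∷ 31 ∷ 32 ∷ 39 ∷ 53 ∷ 59 ∷ []) ∷
      (3 ∷ 15 ∷ 17 ∷ 22 ∷ 28 ∷ 43 ∷ 49 ∷ 54 ∷ 59 ∷ []) ∷
      (3 ∷ 8 ∷ 23 ∷ 24 ∷ 26 ∷ 45 ∷ 55 ∷ 58 ∷ 62 ∷ []) ∷
      (7 ∷ 20 ∷ 30 ∷ 34 ∷ 44 ∷ 51 ∷ 52 ∷ 56 ∷ 60 ∷ []) ∷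
      (8 ∷ 13 ∷ 21 ∷ 26 ∷ 31 ∷ 38 ∷ 42 ∷ 47 ∷ 54 ∷ []) ∷
      (10 ∷ 21 ∷ 27 ∷ 43 ∷ 44 ∷ 49 ∷ 52 ∷ 59 ∷ 61 ∷ []) ∷
      (15 ∷ 16 ∷ 18 ∷ 27 ∷ 31 ∷ 42 ∷ 45 ∷ 53 ∷ 59 ∷ []) ∷
      (4 ∷ 11 ∷ 21 ∷ 23 ∷ 28 ∷ 32 ∷ 33 ∷ 46 ∷ 62 ∷ []) ∷
      (7 ∷ 17 ∷ 24 ∷ 25 ∷ 30 ∷ 40 ∷ 41 ∷ 55 ∷ 63 ∷ []) ∷
      (0 ∷ 9 ∷ 15 ∷ 20 ∷ 26 ∷ 34 ∷ 38 ∷ 39 ∷ 43 ∷ []) ∷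
      (0 ∷ 1 ∷ 12 ∷ 33 ∷ 40 ∷ 44 ∷ 46 ∷ 56 ∷ 62 ∷ []) ∷
      (1 ∷ 2 ∷ 6 ∷ 17 ∷ 19 ∷ 22 ∷ 27 ∷ 50 ∷ 56 ∷ []) ∷
      (6 ∷ 12 ∷ 19 ∷ 23 ∷ 25 ∷ 34 ∷ 37 ∷ 42 ∷ 58 ∷ []) ∷
      (3 ∷ 5 ∷ 8 ∷ 9 ∷ 16 ∷ 19 ∷ 26 ∷ 46 ∷ 48 ∷ []) ∷
      (9 ∷ 11 ∷ 14 ∷ 26 ∷ 29 ∷ 37 ∷ 39 ∷ 48 ∷ 57 ∷ []) ∷
      (6 ∷ 12 ∷ 22 ∷ 28 ∷ 31 ∷ 39 ∷ 40 ∷ 45 ∷ 61 ∷ []) ∷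
      (5 ∷ 6 ∷ 10 ∷ 12 ∷ 18 ∷ 46 ∷ 49 ∷ 52 ∷ 60 ∷ []) ∷
      (0 ∷ 5 ∷ 14 ∷ 40 ∷ 47 ∷ 51 ∷ 57 ∷ 59 ∷ 61 ∷ []) ∷
      (4 ∷ 11 ∷ 31 ∷ 33 ∷ 41 ∷ 46 ∷ 51 ∷ 58 ∷ 63 ∷ []) ∷
      (0 ∷ 2 ∷ 4 ∷ 23 ∷ 28 ∷ 50 ∷ 52 ∷ 55 ∷ 60 ∷ []) ∷
      (2 ∷ 3 ∷ 11 ∷ 19 ∷ 28 ∷ 33 ∷ 34 ∷ 43 ∷ 45 ∷ []) ∷
      (1 ∷ 5 ∷ 18 ∷ 27 ∷ 29 ∷ 34 ∷ 36 ∷ 43 ∷ 61 ∷ []) ∷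
      (6 ∷ 12 ∷ 27 ∷ 37 ∷ 42 ∷ 47 ∷ 53 ∷ 59 ∷ 63 ∷ []) ∷
      (1 ∷ 12 ∷ 23 ∷ 25 ∷ 31 ∷ 41 ∷ 44 ∷ 47 ∷ 54 ∷ []) ∷
      (9 ∷ 17 ∷ 20 ∷ 24 ∷ 28 ∷ 39 ∷ 40 ∷ 51 ∷ 52 ∷ []) ∷
      (15 ∷ 18 ∷ 22 ∷ 24 ∷ 29 ∷ 42 ∷ 45 ∷ 52 ∷ 61 ∷ []) ∷
      (9 ∷ 21 ∷ 25 ∷ 34 ∷ 39 ∷ 44 ∷ 46 ∷ 60 ∷ 62 ∷ []) ∷
      (5 ∷ 26 ∷ 29 ∷ 32 ∷ 35 ∷ 37 ∷ 45 ∷ 54 ∷ 63 ∷ []) ∷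
      (8 ∷ 13 ∷ 23 ∷ 36 ∷ 41 ∷ 42 ∷ 48 ∷ 50 ∷ 55 ∷ []) ∷
      (1 ∷ 10 ∷ 12 ∷ 14 ∷ 16 ∷ 32 ∷ 33 ∷ 47 ∷ 55 ∷ []) ∷
      (4 ∷ 10 ∷ 11 ∷ 15 ∷ 18 ∷ 20 ∷ 24 ∷ 35 ∷ 55 ∷ []) ∷
      (7 ∷ 13 ∷ 14 ∷ 16 ∷ 30 ∷ 38 ∷ 47 ∷ 57 ∷ 58 ∷ []) ∷
      (4 ∷ 11 ∷ 22 ∷ 36 ∷ 37 ∷ 43 ∷ 54 ∷ 57 ∷ 60 ∷ []) ∷
      (5 ∷ 22 ∷ 24 ∷ 35 ∷ 38 ∷ 43 ∷ 44 ∷ 54 ∷ 63 ∷ []) ∷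
      (6 ∷ 12 ∷ 16 ∷ 19 ∷ 25 ∷ 41 ∷ 56 ∷ 62 ∷ 63 ∷ []) ∷
      (14 ∷ 20 ∷ 23 ∷ 42 ∷ 46 ∷ 51 ∷ 52 ∷ 55 ∷ 57 ∷ []) ∷
      (10 ∷ 21 ∷ 27 ∷ 38 ∷ 47 ∷ 48 ∷ 49 ∷ 54 ∷ 58 ∷ []) ∷
      (0 ∷ 7 ∷ 10 ∷ 17 ∷ 22 ∷ 29 ∷ 30 ∷ 53 ∷ 60 ∷ []) ∷
      (1 ∷ 3 ∷ 13 ∷ 33 ∷ 36 ∷ 50 ∷ 51 ∷ 54 ∷ 61 ∷ []) ∷
      (8 ∷ 13 ∷ 17 ∷ 21 ∷ 31 ∷ 37 ∷ 50 ∷ 55 ∷ 62 ∷ []) ∷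
      (0 ∷ 3 ∷ 8 ∷ 19 ∷ 20 ∷ 24 ∷ 25 ∷ 36 ∷ 41 ∷ []) ∷
      (2 ∷ 10 ∷ 22 ∷ 35 ∷ 38 ∷ 45 ∷ 51 ∷ 56 ∷ 61 ∷ []) ∷
      (14 ∷ 17 ∷ 24 ∷ 34 ∷ 36 ∷ 40 ∷ 44 ∷ 57 ∷ 60 ∷ []) ∷
      (4 ∷ 11 ∷ 21 ∷ 26 ∷ 29 ∷ 45 ∷ 53 ∷ 58 ∷ 63 ∷ []) ∷
      (2 ∷ 4 ∷ 27 ∷ 37 ∷ 41 ∷ 46 ∷ 52 ∷ 53 ∷ 62 ∷ []) ∷
      []
  }

graph7-13 : Certificate (2 ^ 7)
graph7-13 = record
  { root       = # 0
  ; parents    = # 0 ∷ # 120 ∷ # 100 ∷ # 15 ∷ # 77 ∷ # 9 ∷ # 77 ∷ # 0 ∷ # 77 ∷ # 0 ∷ # 14 ∷ # 70 ∷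
      # 70 ∷ # 90 ∷ # 0 ∷ # 7 ∷ # 15 ∷ # 18 ∷ # 0 ∷ # 43 ∷ # 36 ∷ # 100 ∷ # 9 ∷ # 7 ∷ # 23 ∷ # 36 ∷
      # 18 ∷ # 64 ∷ # 0 ∷ # 28 ∷ # 64 ∷ # 18 ∷ # 124 ∷ # 61 ∷ # 35 ∷ # 0 ∷ # 0 ∷ # 18 ∷ # 36 ∷
      # 64 ∷ # 56 ∷ # 9 ∷ # 85 ∷ # 7 ∷ # 113 ∷ # 64 ∷ # 28 ∷ # 35 ∷ # 84 ∷ # 0 ∷ # 15 ∷ # 49 ∷
      # 100 ∷ # 49 ∷ # 64 ∷ # 28 ∷ # 0 ∷ # 64 ∷ # 35 ∷ # 56 ∷ # 28 ∷ # 7 ∷ # 14 ∷ # 113 ∷ # 0 ∷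
      # 102 ∷ # 15 ∷ # 93 ∷ # 90 ∷ # 18 ∷ # 9 ∷ # 18 ∷ # 111 ∷ # 35 ∷ # 35 ∷ # 14 ∷ # 124 ∷ # 7 ∷
      # 18 ∷ # 49 ∷ # 105 ∷ # 36 ∷ # 9 ∷ # 49 ∷ # 9 ∷ # 7 ∷ # 85 ∷ # 49 ∷ # 36 ∷ # 85 ∷ # 7 ∷ # 0 ∷
      # 9 ∷ # 7 ∷ # 64 ∷ # 15 ∷ # 126 ∷ # 18 ∷ # 56 ∷ # 14 ∷ # 7 ∷ # 85 ∷ # 9 ∷ # 64 ∷ # 14 ∷
      # 18 ∷ # 9 ∷ # 15 ∷ # 56 ∷ # 0 ∷ # 92 ∷ # 9 ∷ # 17 ∷ # 7 ∷ # 35 ∷ # 28 ∷ # 28 ∷ # 14 ∷ # 0 ∷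
      # 100 ∷ # 7 ∷ # 64 ∷ # 43 ∷ # 14 ∷ # 7 ∷ # 23 ∷ # 35 ∷ # 14 ∷ []
  ; neighbours =
      (7 ∷ 9 ∷ 14 ∷ 18 ∷ 28 ∷ 35 ∷ 36 ∷ 49 ∷ 56 ∷ 64 ∷ 91 ∷ 109 ∷ 118 ∷ []) ∷
      (5 ∷ 21 ∷ 45 ∷ 52 ∷ 60 ∷ 65 ∷ 76 ∷ 83 ∷ 92 ∷ 95 ∷ 98 ∷ 114 ∷ 120 ∷ []) ∷
      (10 ∷ 20 ∷ 24 ∷ 42 ∷ 54 ∷ 66 ∷ 68 ∷ 83 ∷ 92 ∷ 97 ∷ 100 ∷ 101 ∷ 115 ∷ []) ∷
      (15 ∷ 27 ∷ 40 ∷ 44 ∷ 63 ∷ 67 ∷ 72 ∷ 81 ∷ 97 ∷ 100 ∷ 114 ∷ 120 ∷ 122 ∷ []) ∷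
      (19 ∷ 20 ∷ 21 ∷ 51 ∷ 54 ∷ 68 ∷ 74 ∷ 75 ∷ 77 ∷ 99 ∷ 112 ∷ 113 ∷ 125 ∷ []) ∷
      (1 ∷ 9 ∷ 19 ∷ 30 ∷ 32 ∷ 67 ∷ 87 ∷ 94 ∷ 100 ∷ 101 ∷ 109 ∷ 125 ∷ 126 ∷ []) ∷
      (32 ∷ 40 ∷ 53 ∷ 55 ∷ 59 ∷ 68 ∷ 77 ∷ 78 ∷ 85 ∷ 86 ∷ 98 ∷ 111 ∷ 120 ∷ []) ∷
      (0 ∷ 15 ∷ 23 ∷ 43 ∷ 61 ∷ 77 ∷ 85 ∷ 90 ∷ 93 ∷ 100 ∷ 113 ∷ 120 ∷ 124 ∷ []) ∷
      (17 ∷ 27 ∷ 33 ∷ 40 ∷ 42 ∷ 70 ∷ 72 ∷ 77 ∷ 79 ∷ 80 ∷ 82 ∷ 86 ∷ 113 ∷ []) ∷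
      (0 ∷ 5 ∷ 22 ∷ 41 ∷ 61 ∷ 70 ∷ 82 ∷ 84 ∷ 92 ∷ 102 ∷ 106 ∷ 111 ∷ 120 ∷ []) ∷
      (2 ∷ 14 ∷ 33 ∷ 39 ∷ 48 ∷ 65 ∷ 86 ∷ 87 ∷ 103 ∷ 105 ∷ 118 ∷ 120 ∷ 122 ∷ []) ∷
      (25 ∷ 26 ∷ 29 ∷ 48 ∷ 60 ∷ 70 ∷ 71 ∷ 72 ∷ 92 ∷ 106 ∷ 107 ∷ 115 ∷ 117 ∷ []) ∷
      (34 ∷ 45 ∷ 50 ∷ 60 ∷ 63 ∷ 69 ∷ 70 ∷ 75 ∷ 76 ∷ 82 ∷ 96 ∷ 99 ∷ 107 ∷ []) ∷
      (16 ∷ 20 ∷ 38 ∷ 46 ∷ 47 ∷ 73 ∷ 75 ∷ 76 ∷ 81 ∷ 90 ∷ 100 ∷ 125 ∷ 127 ∷ []) ∷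
      (0 ∷ 10 ∷ 22 ∷ 43 ∷ 62 ∷ 75 ∷ 92 ∷ 99 ∷ 100 ∷ 104 ∷ 117 ∷ 123 ∷ 127 ∷ []) ∷
      (3 ∷ 7 ∷ 16 ∷ 50 ∷ 57 ∷ 66 ∷ 91 ∷ 92 ∷ 95 ∷ 105 ∷ 107 ∷ 121 ∷ 126 ∷ []) ∷
      (13 ∷ 15 ∷ 17 ∷ 21 ∷ 27 ∷ 67 ∷ 71 ∷ 78 ∷ 80 ∷ 104 ∷ 108 ∷ 116 ∷ 119 ∷ []) ∷
      (8 ∷ 16 ∷ 18 ∷ 39 ∷ 52 ∷ 73 ∷ 89 ∷ 91 ∷ 95 ∷ 103 ∷ 111 ∷ 112 ∷ 117 ∷ []) ∷
      (0 ∷ 17 ∷ 26 ∷ 31 ∷ 37 ∷ 69 ∷ 71 ∷ 78 ∷ 97 ∷ 100 ∷ 105 ∷ 106 ∷ 123 ∷ []) ∷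
      (4 ∷ 5 ∷ 41 ∷ 43 ∷ 59 ∷ 67 ∷ 73 ∷ 82 ∷ 84 ∷ 95 ∷ 102 ∷ 114 ∷ 127 ∷ []) ∷
      (2 ∷ 4 ∷ 13 ∷ 36 ∷ 57 ∷ 76 ∷ 82 ∷ 86 ∷ 93 ∷ 118 ∷ 119 ∷ 121 ∷ 123 ∷ []) ∷
      (1 ∷ 4 ∷ 16 ∷ 65 ∷ 68 ∷ 69 ∷ 73 ∷ 80 ∷ 81 ∷ 82 ∷ 84 ∷ 100 ∷ 127 ∷ []) ∷
      (9 ∷ 14 ∷ 25 ∷ 26 ∷ 29 ∷ 37 ∷ 50 ∷ 55 ∷ 58 ∷ 97 ∷ 101 ∷ 104 ∷ 111 ∷ []) ∷
      (7 ∷ 24 ∷ 29 ∷ 37 ∷ 50 ∷ 53 ∷ 55 ∷ 77 ∷ 95 ∷ 105 ∷ 109 ∷ 124 ∷ 125 ∷ []) ∷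
      (2 ∷ 23 ∷ 31 ∷ 34 ∷ 47 ∷ 74 ∷ 80 ∷ 85 ∷ 89 ∷ 99 ∷ 116 ∷ 120 ∷ 126 ∷ []) ∷
      (11 ∷ 22 ∷ 31 ∷ 36 ∷ 37 ∷ 41 ∷ 43 ∷ 53 ∷ 56 ∷ 70 ∷ 86 ∷ 98 ∷ 126 ∷ []) ∷
      (11 ∷ 18 ∷ 22 ∷ 38 ∷ 41 ∷ 46 ∷ 52 ∷ 69 ∷ 89 ∷ 97 ∷ 101 ∷ 109 ∷ 111 ∷ []) ∷
      (3 ∷ 8 ∷ 16 ∷ 64 ∷ 74 ∷ 84 ∷ 86 ∷ 102 ∷ 115 ∷ 117 ∷ 119 ∷ 122 ∷ 126 ∷ []) ∷
      (0 ∷ 29 ∷ 46 ∷ 55 ∷ 60 ∷ 71 ∷ 82 ∷ 85 ∷ 99 ∷ 105 ∷ 115 ∷ 116 ∷ 117 ∷ []) ∷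
      (11 ∷ 22 ∷ 23 ∷ 28 ∷ 31 ∷ 33 ∷ 53 ∷ 102 ∷ 115 ∷ 116 ∷ 118 ∷ 119 ∷ 125 ∷ []) ∷
      (5 ∷ 40 ∷ 51 ∷ 64 ∷ 75 ∷ 87 ∷ 89 ∷ 97 ∷ 102 ∷ 111 ∷ 116 ∷ 122 ∷ 125 ∷ []) ∷
      (18 ∷ 24 ∷ 25 ∷ 29 ∷ 43 ∷ 49 ∷ 55 ∷ 61 ∷ 62 ∷ 69 ∷ 102 ∷ 116 ∷ 119 ∷ []) ∷
      (5 ∷ 6 ∷ 34 ∷ 42 ∷ 45 ∷ 65 ∷ 71 ∷ 73 ∷ 88 ∷ 89 ∷ 96 ∷ 116 ∷ 124 ∷ []) ∷
      (8 ∷ 10 ∷ 29 ∷ 61 ∷ 62 ∷ 65 ∷ 78 ∷ 83 ∷ 85 ∷ 99 ∷ 101 ∷ 104 ∷ 123 ∷ []) ∷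
      (12 ∷ 24 ∷ 32 ∷ 35 ∷ 57 ∷ 78 ∷ 80 ∷ 90 ∷ 101 ∷ 109 ∷ 110 ∷ 117 ∷ 121 ∷ []) ∷
      (0 ∷ 34 ∷ 37 ∷ 47 ∷ 58 ∷ 71 ∷ 73 ∷ 74 ∷ 93 ∷ 114 ∷ 120 ∷ 126 ∷ 127 ∷ []) ∷
      (0 ∷ 20 ∷ 25 ∷ 38 ∷ 55 ∷ 73 ∷ 81 ∷ 88 ∷ 90 ∷ 99 ∷ 106 ∷ 113 ∷ 126 ∷ []) ∷
      (18 ∷ 22 ∷ 23 ∷ 25 ∷ 35 ∷ 38 ∷ 44 ∷ 46 ∷ 61 ∷ 74 ∷ 88 ∷ 89 ∷ 123 ∷ []) ∷
      (13 ∷ 26 ∷ 36 ∷ 37 ∷ 41 ∷ 43 ∷ 50 ∷ 81 ∷ 86 ∷ 88 ∷ 89 ∷ 91 ∷ 123 ∷ []) ∷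
      (10 ∷ 17 ∷ 60 ∷ 64 ∷ 77 ∷ 86 ∷ 88 ∷ 95 ∷ 105 ∷ 110 ∷ 114 ∷ 117 ∷ 123 ∷ []) ∷
      (3 ∷ 6 ∷ 8 ∷ 30 ∷ 56 ∷ 68 ∷ 89 ∷ 91 ∷ 93 ∷ 94 ∷ 99 ∷ 102 ∷ 107 ∷ []) ∷
      (9 ∷ 19 ∷ 25 ∷ 26 ∷ 38 ∷ 44 ∷ 58 ∷ 70 ∷ 84 ∷ 86 ∷ 101 ∷ 118 ∷ 126 ∷ []) ∷
      (2 ∷ 8 ∷ 32 ∷ 66 ∷ 72 ∷ 74 ∷ 78 ∷ 85 ∷ 96 ∷ 98 ∷ 99 ∷ 104 ∷ 120 ∷ []) ∷
      (7 ∷ 14 ∷ 19 ∷ 25 ∷ 31 ∷ 38 ∷ 46 ∷ 47 ∷ 58 ∷ 114 ∷ 117 ∷ 122 ∷ 124 ∷ []) ∷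
      (3 ∷ 37 ∷ 41 ∷ 51 ∷ 53 ∷ 79 ∷ 87 ∷ 88 ∷ 92 ∷ 96 ∷ 106 ∷ 110 ∷ 113 ∷ []) ∷
      (1 ∷ 12 ∷ 32 ∷ 64 ∷ 79 ∷ 81 ∷ 87 ∷ 89 ∷ 90 ∷ 95 ∷ 104 ∷ 107 ∷ 123 ∷ []) ∷
      (13 ∷ 26 ∷ 28 ∷ 37 ∷ 43 ∷ 56 ∷ 58 ∷ 61 ∷ 62 ∷ 75 ∷ 87 ∷ 107 ∷ 115 ∷ []) ∷
      (13 ∷ 24 ∷ 35 ∷ 43 ∷ 55 ∷ 59 ∷ 62 ∷ 74 ∷ 110 ∷ 114 ∷ 117 ∷ 118 ∷ 122 ∷ []) ∷
      (10 ∷ 11 ∷ 51 ∷ 54 ∷ 63 ∷ 66 ∷ 73 ∷ 78 ∷ 84 ∷ 88 ∷ 108 ∷ 110 ∷ 112 ∷ []) ∷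
      (0 ∷ 31 ∷ 51 ∷ 53 ∷ 58 ∷ 73 ∷ 78 ∷ 79 ∷ 83 ∷ 85 ∷ 87 ∷ 92 ∷ 102 ∷ []) ∷
      (12 ∷ 15 ∷ 22 ∷ 23 ∷ 38 ∷ 66 ∷ 71 ∷ 93 ∷ 97 ∷ 106 ∷ 113 ∷ 122 ∷ 124 ∷ []) ∷
      (4 ∷ 30 ∷ 44 ∷ 48 ∷ 49 ∷ 71 ∷ 90 ∷ 94 ∷ 96 ∷ 111 ∷ 118 ∷ 119 ∷ 122 ∷ []) ∷
      (1 ∷ 17 ∷ 26 ∷ 58 ∷ 62 ∷ 69 ∷ 82 ∷ 100 ∷ 105 ∷ 108 ∷ 112 ∷ 119 ∷ 127 ∷ []) ∷
      (6 ∷ 23 ∷ 25 ∷ 29 ∷ 44 ∷ 49 ∷ 61 ∷ 79 ∷ 83 ∷ 90 ∷ 91 ∷ 95 ∷ 119 ∷ []) ∷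
      (2 ∷ 4 ∷ 48 ∷ 64 ∷ 69 ∷ 93 ∷ 98 ∷ 101 ∷ 105 ∷ 110 ∷ 111 ∷ 124 ∷ 125 ∷ []) ∷
      (6 ∷ 22 ∷ 23 ∷ 28 ∷ 31 ∷ 36 ∷ 47 ∷ 58 ∷ 61 ∷ 77 ∷ 81 ∷ 105 ∷ 125 ∷ []) ∷
      (0 ∷ 25 ∷ 40 ∷ 46 ∷ 59 ∷ 78 ∷ 82 ∷ 87 ∷ 98 ∷ 108 ∷ 111 ∷ 113 ∷ 127 ∷ []) ∷
      (15 ∷ 20 ∷ 34 ∷ 64 ∷ 70 ∷ 83 ∷ 90 ∷ 93 ∷ 101 ∷ 107 ∷ 108 ∷ 119 ∷ 126 ∷ []) ∷
      (22 ∷ 35 ∷ 41 ∷ 43 ∷ 46 ∷ 49 ∷ 52 ∷ 55 ∷ 59 ∷ 79 ∷ 93 ∷ 108 ∷ 110 ∷ []) ∷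
      (6 ∷ 19 ∷ 47 ∷ 56 ∷ 58 ∷ 61 ∷ 62 ∷ 93 ∷ 98 ∷ 107 ∷ 108 ∷ 109 ∷ 110 ∷ []) ∷
      (1 ∷ 11 ∷ 12 ∷ 28 ∷ 39 ∷ 72 ∷ 102 ∷ 103 ∷ 109 ∷ 110 ∷ 113 ∷ 123 ∷ 125 ∷ []) ∷
      (7 ∷ 9 ∷ 31 ∷ 33 ∷ 37 ∷ 46 ∷ 53 ∷ 55 ∷ 59 ∷ 83 ∷ 84 ∷ 90 ∷ 95 ∷ []) ∷
      (14 ∷ 31 ∷ 33 ∷ 46 ∷ 47 ∷ 52 ∷ 59 ∷ 75 ∷ 87 ∷ 91 ∷ 104 ∷ 107 ∷ 122 ∷ []) ∷
      (3 ∷ 12 ∷ 48 ∷ 67 ∷ 71 ∷ 76 ∷ 79 ∷ 92 ∷ 106 ∷ 112 ∷ 113 ∷ 115 ∷ 124 ∷ []) ∷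
      (0 ∷ 27 ∷ 30 ∷ 39 ∷ 45 ∷ 54 ∷ 57 ∷ 85 ∷ 94 ∷ 103 ∷ 106 ∷ 121 ∷ 127 ∷ []) ∷
      (1 ∷ 10 ∷ 21 ∷ 32 ∷ 33 ∷ 68 ∷ 69 ∷ 76 ∷ 80 ∷ 96 ∷ 102 ∷ 121 ∷ 125 ∷ []) ∷
      (2 ∷ 15 ∷ 42 ∷ 48 ∷ 50 ∷ 68 ∷ 72 ∷ 74 ∷ 86 ∷ 94 ∷ 96 ∷ 112 ∷ 123 ∷ []) ∷
      (3 ∷ 5 ∷ 16 ∷ 19 ∷ 63 ∷ 72 ∷ 76 ∷ 79 ∷ 80 ∷ 93 ∷ 103 ∷ 107 ∷ 112 ∷ []) ∷
      (2 ∷ 4 ∷ 6 ∷ 21 ∷ 40 ∷ 65 ∷ 66 ∷ 80 ∷ 84 ∷ 90 ∷ 103 ∷ 112 ∷ 119 ∷ []) ∷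
      (12 ∷ 18 ∷ 21 ∷ 26 ∷ 31 ∷ 52 ∷ 54 ∷ 65 ∷ 77 ∷ 91 ∷ 93 ∷ 97 ∷ 103 ∷ []) ∷
      (8 ∷ 9 ∷ 11 ∷ 12 ∷ 25 ∷ 41 ∷ 57 ∷ 74 ∷ 84 ∷ 88 ∷ 94 ∷ 97 ∷ 118 ∷ []) ∷
      (11 ∷ 16 ∷ 18 ∷ 28 ∷ 32 ∷ 35 ∷ 50 ∷ 51 ∷ 63 ∷ 92 ∷ 107 ∷ 110 ∷ 113 ∷ []) ∷
      (3 ∷ 8 ∷ 11 ∷ 42 ∷ 60 ∷ 66 ∷ 67 ∷ 80 ∷ 89 ∷ 96 ∷ 104 ∷ 111 ∷ 121 ∷ []) ∷
      (13 ∷ 17 ∷ 19 ∷ 21 ∷ 32 ∷ 35 ∷ 36 ∷ 48 ∷ 49 ∷ 82 ∷ 100 ∷ 119 ∷ 125 ∷ []) ∷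
      (4 ∷ 24 ∷ 27 ∷ 35 ∷ 37 ∷ 42 ∷ 47 ∷ 66 ∷ 70 ∷ 102 ∷ 109 ∷ 114 ∷ 121 ∷ []) ∷
      (4 ∷ 12 ∷ 13 ∷ 14 ∷ 30 ∷ 46 ∷ 62 ∷ 79 ∷ 91 ∷ 103 ∷ 104 ∷ 108 ∷ 114 ∷ []) ∷
      (1 ∷ 12 ∷ 13 ∷ 20 ∷ 63 ∷ 65 ∷ 67 ∷ 94 ∷ 96 ∷ 110 ∷ 112 ∷ 117 ∷ 124 ∷ []) ∷
      (4 ∷ 6 ∷ 7 ∷ 8 ∷ 23 ∷ 39 ∷ 55 ∷ 69 ∷ 83 ∷ 109 ∷ 116 ∷ 121 ∷ 124 ∷ []) ∷
      (6 ∷ 16 ∷ 18 ∷ 33 ∷ 34 ∷ 42 ∷ 48 ∷ 49 ∷ 56 ∷ 86 ∷ 89 ∷ 99 ∷ 120 ∷ []) ∷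
      (8 ∷ 44 ∷ 45 ∷ 49 ∷ 53 ∷ 58 ∷ 63 ∷ 67 ∷ 75 ∷ 83 ∷ 94 ∷ 118 ∷ 123 ∷ []) ∷
      (8 ∷ 16 ∷ 21 ∷ 24 ∷ 34 ∷ 65 ∷ 67 ∷ 68 ∷ 72 ∷ 81 ∷ 94 ∷ 95 ∷ 105 ∷ []) ∷
      (3 ∷ 13 ∷ 21 ∷ 36 ∷ 38 ∷ 45 ∷ 55 ∷ 80 ∷ 83 ∷ 87 ∷ 88 ∷ 118 ∷ 121 ∷ []) ∷
      (8 ∷ 9 ∷ 12 ∷ 19 ∷ 20 ∷ 21 ∷ 28 ∷ 52 ∷ 56 ∷ 73 ∷ 95 ∷ 100 ∷ 125 ∷ []) ∷
      (1 ∷ 2 ∷ 33 ∷ 49 ∷ 53 ∷ 57 ∷ 61 ∷ 77 ∷ 79 ∷ 81 ∷ 91 ∷ 94 ∷ 116 ∷ []) ∷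
      (9 ∷ 19 ∷ 21 ∷ 27 ∷ 41 ∷ 48 ∷ 61 ∷ 68 ∷ 70 ∷ 94 ∷ 109 ∷ 116 ∷ 117 ∷ []) ∷
      (6 ∷ 7 ∷ 24 ∷ 28 ∷ 33 ∷ 42 ∷ 49 ∷ 64 ∷ 86 ∷ 89 ∷ 101 ∷ 106 ∷ 127 ∷ []) ∷
      (6 ∷ 8 ∷ 10 ∷ 20 ∷ 25 ∷ 27 ∷ 38 ∷ 39 ∷ 41 ∷ 66 ∷ 78 ∷ 85 ∷ 99 ∷ []) ∷
      (5 ∷ 10 ∷ 30 ∷ 44 ∷ 45 ∷ 46 ∷ 49 ∷ 56 ∷ 62 ∷ 81 ∷ 93 ∷ 112 ∷ 117 ∷ []) ∷
      (32 ∷ 36 ∷ 37 ∷ 38 ∷ 39 ∷ 44 ∷ 48 ∷ 70 ∷ 81 ∷ 91 ∷ 97 ∷ 104 ∷ 121 ∷ []) ∷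
      (17 ∷ 24 ∷ 26 ∷ 30 ∷ 32 ∷ 37 ∷ 38 ∷ 40 ∷ 45 ∷ 72 ∷ 78 ∷ 85 ∷ 120 ∷ []) ∷
      (7 ∷ 13 ∷ 34 ∷ 36 ∷ 45 ∷ 51 ∷ 53 ∷ 57 ∷ 61 ∷ 68 ∷ 102 ∷ 104 ∷ 105 ∷ []) ∷
      (0 ∷ 15 ∷ 17 ∷ 38 ∷ 40 ∷ 53 ∷ 62 ∷ 69 ∷ 75 ∷ 83 ∷ 88 ∷ 98 ∷ 124 ∷ []) ∷
      (1 ∷ 2 ∷ 9 ∷ 11 ∷ 14 ∷ 15 ∷ 44 ∷ 49 ∷ 63 ∷ 71 ∷ 110 ∷ 113 ∷ 122 ∷ []) ∷
      (7 ∷ 20 ∷ 35 ∷ 40 ∷ 50 ∷ 54 ∷ 57 ∷ 58 ∷ 59 ∷ 67 ∷ 69 ∷ 87 ∷ 117 ∷ []) ∷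
      (5 ∷ 40 ∷ 51 ∷ 64 ∷ 66 ∷ 70 ∷ 76 ∷ 79 ∷ 80 ∷ 83 ∷ 84 ∷ 98 ∷ 108 ∷ []) ∷
      (1 ∷ 15 ∷ 17 ∷ 19 ∷ 23 ∷ 39 ∷ 45 ∷ 53 ∷ 61 ∷ 80 ∷ 82 ∷ 100 ∷ 127 ∷ []) ∷
      (12 ∷ 32 ∷ 42 ∷ 44 ∷ 51 ∷ 65 ∷ 66 ∷ 72 ∷ 76 ∷ 98 ∷ 101 ∷ 103 ∷ 126 ∷ []) ∷
      (2 ∷ 3 ∷ 18 ∷ 22 ∷ 26 ∷ 30 ∷ 50 ∷ 69 ∷ 70 ∷ 88 ∷ 98 ∷ 103 ∷ 109 ∷ []) ∷
      (1 ∷ 6 ∷ 25 ∷ 42 ∷ 54 ∷ 56 ∷ 59 ∷ 91 ∷ 94 ∷ 96 ∷ 97 ∷ 105 ∷ 108 ∷ []) ∷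
      (4 ∷ 12 ∷ 14 ∷ 24 ∷ 28 ∷ 33 ∷ 36 ∷ 40 ∷ 42 ∷ 78 ∷ 86 ∷ 101 ∷ 120 ∷ []) ∷
      (2 ∷ 3 ∷ 5 ∷ 7 ∷ 13 ∷ 14 ∷ 18 ∷ 21 ∷ 52 ∷ 73 ∷ 82 ∷ 95 ∷ 119 ∷ []) ∷
      (2 ∷ 5 ∷ 22 ∷ 26 ∷ 33 ∷ 34 ∷ 41 ∷ 54 ∷ 57 ∷ 85 ∷ 96 ∷ 99 ∷ 120 ∷ []) ∷
      (9 ∷ 19 ∷ 27 ∷ 29 ∷ 30 ∷ 31 ∷ 40 ∷ 49 ∷ 60 ∷ 65 ∷ 74 ∷ 90 ∷ 105 ∷ []) ∷
      (10 ∷ 17 ∷ 60 ∷ 64 ∷ 67 ∷ 68 ∷ 69 ∷ 75 ∷ 96 ∷ 97 ∷ 104 ∷ 115 ∷ 116 ∷ []) ∷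
      (14 ∷ 16 ∷ 22 ∷ 33 ∷ 42 ∷ 45 ∷ 62 ∷ 72 ∷ 75 ∷ 88 ∷ 90 ∷ 103 ∷ 118 ∷ []) ∷
      (10 ∷ 15 ∷ 18 ∷ 23 ∷ 28 ∷ 39 ∷ 52 ∷ 54 ∷ 55 ∷ 80 ∷ 90 ∷ 98 ∷ 102 ∷ []) ∷
      (9 ∷ 11 ∷ 18 ∷ 36 ∷ 44 ∷ 50 ∷ 63 ∷ 64 ∷ 85 ∷ 107 ∷ 110 ∷ 122 ∷ 127 ∷ []) ∷
      (11 ∷ 12 ∷ 15 ∷ 40 ∷ 45 ∷ 46 ∷ 57 ∷ 59 ∷ 62 ∷ 67 ∷ 71 ∷ 106 ∷ 113 ∷ []) ∷
      (16 ∷ 48 ∷ 52 ∷ 56 ∷ 57 ∷ 58 ∷ 59 ∷ 75 ∷ 94 ∷ 98 ∷ 109 ∷ 114 ∷ 124 ∷ []) ∷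
      (0 ∷ 5 ∷ 23 ∷ 26 ∷ 34 ∷ 59 ∷ 60 ∷ 74 ∷ 77 ∷ 84 ∷ 97 ∷ 108 ∷ 115 ∷ []) ∷
      (34 ∷ 39 ∷ 44 ∷ 47 ∷ 48 ∷ 54 ∷ 58 ∷ 59 ∷ 60 ∷ 71 ∷ 76 ∷ 92 ∷ 106 ∷ []) ∷
      (6 ∷ 9 ∷ 17 ∷ 22 ∷ 26 ∷ 30 ∷ 51 ∷ 54 ∷ 56 ∷ 72 ∷ 123 ∷ 124 ∷ 126 ∷ []) ∷
      (4 ∷ 17 ∷ 48 ∷ 52 ∷ 63 ∷ 66 ∷ 67 ∷ 68 ∷ 76 ∷ 87 ∷ 115 ∷ 121 ∷ 122 ∷ []) ∷
      (4 ∷ 7 ∷ 8 ∷ 36 ∷ 44 ∷ 50 ∷ 56 ∷ 60 ∷ 63 ∷ 71 ∷ 92 ∷ 107 ∷ 122 ∷ []) ∷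
      (1 ∷ 3 ∷ 19 ∷ 35 ∷ 39 ∷ 43 ∷ 47 ∷ 74 ∷ 75 ∷ 108 ∷ 115 ∷ 118 ∷ 121 ∷ []) ∷
      (2 ∷ 11 ∷ 27 ∷ 28 ∷ 29 ∷ 46 ∷ 63 ∷ 103 ∷ 109 ∷ 112 ∷ 114 ∷ 116 ∷ 126 ∷ []) ∷
      (16 ∷ 24 ∷ 28 ∷ 29 ∷ 30 ∷ 31 ∷ 32 ∷ 77 ∷ 83 ∷ 84 ∷ 103 ∷ 115 ∷ 118 ∷ []) ∷
      (11 ∷ 14 ∷ 17 ∷ 27 ∷ 28 ∷ 34 ∷ 39 ∷ 43 ∷ 47 ∷ 76 ∷ 84 ∷ 87 ∷ 93 ∷ []) ∷
      (0 ∷ 10 ∷ 20 ∷ 29 ∷ 41 ∷ 47 ∷ 51 ∷ 70 ∷ 79 ∷ 81 ∷ 104 ∷ 114 ∷ 116 ∷ []) ∷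
      (16 ∷ 20 ∷ 27 ∷ 29 ∷ 31 ∷ 51 ∷ 52 ∷ 53 ∷ 57 ∷ 68 ∷ 73 ∷ 100 ∷ 127 ∷ []) ∷
      (1 ∷ 3 ∷ 6 ∷ 7 ∷ 9 ∷ 10 ∷ 24 ∷ 35 ∷ 42 ∷ 78 ∷ 89 ∷ 99 ∷ 101 ∷ []) ∷
      (15 ∷ 20 ∷ 34 ∷ 64 ∷ 65 ∷ 72 ∷ 74 ∷ 77 ∷ 81 ∷ 88 ∷ 112 ∷ 114 ∷ 124 ∷ []) ∷
      (3 ∷ 10 ∷ 27 ∷ 30 ∷ 43 ∷ 47 ∷ 50 ∷ 51 ∷ 62 ∷ 92 ∷ 106 ∷ 112 ∷ 113 ∷ []) ∷
      (14 ∷ 18 ∷ 20 ∷ 33 ∷ 37 ∷ 38 ∷ 39 ∷ 45 ∷ 60 ∷ 66 ∷ 79 ∷ 111 ∷ 126 ∷ []) ∷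
      (7 ∷ 23 ∷ 32 ∷ 43 ∷ 50 ∷ 54 ∷ 63 ∷ 76 ∷ 77 ∷ 91 ∷ 108 ∷ 111 ∷ 121 ∷ []) ∷
      (4 ∷ 5 ∷ 13 ∷ 23 ∷ 29 ∷ 30 ∷ 54 ∷ 55 ∷ 60 ∷ 65 ∷ 73 ∷ 82 ∷ 127 ∷ []) ∷
      (5 ∷ 15 ∷ 24 ∷ 25 ∷ 27 ∷ 35 ∷ 36 ∷ 41 ∷ 57 ∷ 96 ∷ 111 ∷ 115 ∷ 123 ∷ []) ∷
      (13 ∷ 14 ∷ 19 ∷ 21 ∷ 35 ∷ 52 ∷ 56 ∷ 64 ∷ 85 ∷ 95 ∷ 106 ∷ 119 ∷ 125 ∷ []) ∷
      []
  }

theorem5 : ∀ n k → Case n k →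
    Σ (SimpleGraph (2 ^ n)) λ G → IsRegular k G × IsOpenXORMagic n G
theorem5 _ _ c4-5  = fromCertificate 4 5 graph4-5
theorem5 _ _ c4-7  = fromCertificate 4 7 graph4-7
theorem5 _ _ c4-9  = fromCertificate 4 9 graph4-9
theorem5 _ _ c4-11 = fromCertificate 4 11 graph4-11
theorem5 _ _ c5-5  = fromCertificate 5 5 graph5-5
theorem5 _ _ c5-7  = fromCertificate 5 7 graph5-7
theorem5 _ _ c5-9  = fromCertificate 5 9 graph5-9
theorem5 _ _ c5-11 = fromCertificate 5 11 graph5-11
theorem5 _ _ c5-13 = fromCertificate 5 13 graph5-13
theorem5 _ _ c5-15 = fromCertificate 5 15 graph5-15
theorem5 _ _ c5-27 = fromCertificate 5 27 graph5-27
theorem5 _ _ c6-9  = fromCertificate 6 9 graph6-9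
theorem5 _ _ c7-13 = fromCertificate 7 13 graph7-13
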